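{- For every integer $n\geqslant 2$, let $A_n(x,1,1)=\sum_{\pi\in\mathfrak{S}_n}x^{{\rm basc}(\pi)}$ (a polynomial of degree $n-2$ with nonzero constant term). Then the polynomial $x^{n-2}A_n(1/x,1,1)$ is bi-$\gamma$-positive, and consequently $A_n(x,1,1)$ is spiral: writing $A_n(x,1,1)=\sum_{i=0}^{n-2}f_ix^i$, $$f_{n-2}\leqslant f_0\leqslant f_{n-3}\leqslant f_1\leqslant\cdots\leqslant f_{\lfloor (n-2)/2\rfloor}.$$
   Context: For $\pi\in\mathfrak{S}_n$, ${\rm basc}(\pi)=\#\{i\in[n-1]:\pi(i+1)\geqslant\pi(i)+2\}$ (big ascents). A polynomial $g$ is $\gamma$-positive with respect to $m$ if $g(x)=\sum_k\gamma_kx^k(1+x)^{m-2k}$ with all $\gamma_k\geqslant0$. A real polynomial $f$ of degree $m$ with $f(0)\neq0$ has symmetric decomposition $f=a+xb$ with $a(x)=\frac{f(x)-x^{m+1}f(1/x)}{1-x}$, $b(x)=\frac{x^mf(1/x)-f(x)}{1-x}$; $f$ is bi-$\gamma$-positive if $a$ is $\gamma$-positive with respect to $m$ and $b$ is $\gamma$-positive with respect to $m-1$. -}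

module Defs where

open import Data.Nat using (ℕ; zero; suc; _+_; _*_; _∸_; _≤ᵇ_; _/_; _≤_; _<_)
open import Data.Nat.Combinatorics using (_C_)
open import Data.Integer as ℤ using (ℤ; +_)
open import Data.List using (List; []; _∷_; concatMap; map; length; filter; upTo; foldr)
open import Data.Bool using (Bool; true; false; if_then_else_)
open import Data.Product using (Σ; _×_)
open import Relation.Binary.PropositionalEquality using (_≡_)
open import Data.Nat using (_≟_)

-- Permutations of {0,…,n-1} as lists (one-line notation), generated by
-- inserting the largest letter n-1 in every position of every
-- permutation of {0,…,n-2}. Each permutation appears exactly once.

insertions : ℕ → List ℕ → List (List ℕ)
insertions x []       = (x ∷ []) ∷ []
insertions x (y ∷ ys) = (x ∷ y ∷ ys) ∷ map (y ∷_) (insertions x ys)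

perms : ℕ → List (List ℕ)
perms zero    = [] ∷ []
perms (suc n) = concatMap (insertions n) (perms n)

basc : List ℕ → ℕ
basc (x ∷ y ∷ l) = (if x + 2 ≤ᵇ y then 1 else 0) + basc (y ∷ l)
basc _           = 0

A-coeff : ℕ → ℕ → ℕ
A-coeff n k = length (filter (λ π → basc π ≟ k) (perms n))

-- Polynomials with integer coefficients, represented by their
-- coefficient function ℕ → ℤ (coefficient of x^i).

sumℤ : List ℤ → ℤ
sumℤ = foldr ℤ._+_ (+ 0)

partialSum : (ℕ → ℤ) → ℕ → ℤ
partialSum c i = sumℤ (map c (upTo (suc i)))

-- coefficient of x^j in x^m g(1/x)  (= g(m-j) for j ≤ m, else 0)
revCoeff : ℕ → (ℕ → ℤ) → ℕ → ℤ
revCoeff m g j = if j ≤ᵇ m then g (m ∸ j) else + 0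

-- symmetric decomposition g = a + x b, with g of degree m:
-- a(x) = (g(x) - x^{m+1} g(1/x)) / (1 - x)
symA : ℕ → (ℕ → ℤ) → ℕ → ℤ
symA m g = partialSum (λ j → g j ℤ.- revCoeff (suc m) g j)

-- b(x) = (x^m g(1/x) - g(x)) / (1 - x)
symB : ℕ → (ℕ → ℤ) → ℕ → ℤ
symB m g = partialSum (λ j → revCoeff m g j ℤ.- g j)

-- coefficient of x^i in x^k (1+x)^{m-2k}
gammaBasisCoeff : ℕ → ℕ → ℕ → ℕ
gammaBasisCoeff m k i = if k ≤ᵇ i then (m ∸ (2 * k)) C (i ∸ k) else 0

GammaPositive : ℕ → (ℕ → ℤ) → Set
GammaPositive m p =
  Σ (ℕ → ℕ) λ γ → ∀ i →
    p i ≡ + (foldr _+_ 0 (map (λ k → γ k * gammaBasisCoeff m k i) (upTo (suc (m / 2)))))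

BiGammaPositive : ℕ → (ℕ → ℤ) → Set
BiGammaPositive m g = GammaPositive m (symA m g) × GammaPositive (m ∸ 1) (symB m g)

Spiral : ℕ → (ℕ → ℕ) → Set
Spiral m f =
  (∀ i → 2 * i + 1 ≤ m → f (m ∸ i) ≤ f i) ×
  (∀ i → 2 * i + 2 ≤ m → f i ≤ f (m ∸ 1 ∸ i))

revA : ℕ → ℕ → ℤ
revA n i = if i ≤ᵇ (n ∸ 2) then + A-coeff n ((n ∸ 2) ∸ i) else + 0

{-# OPTIONS --safe #-}
module Submission where

-- Inserting the largest letter n into the n + 1 slots of a permutation of {0, …, n − 1} with k big
-- ascents keeps k in the front slot, the slot after n − 1 and the k slots after a letter starting a
-- big ascent, and raises it to k + 1 in the other n − k − 1 slots. Hence A_{n+1} = 𝒯 A_n + A_n with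
-- 𝒯 q = (1 + (d + 1) x) q + x (1 − x) q′, d = n − 2. This 𝒯 maps xᵏ(1+x)^(d−2k) to
-- (k+1) xᵏ(1+x)^(d+1−2k) + 2(d−2k) x^(k+1)(1+x)^(d−1−2k), so if A_n = a + b with a and b nonnegative
-- combinations of the xᵏ(1+x)^(d−2k) and of the xᵏ(1+x)^(d−1−2k), then A_{n+1} splits in the same
-- way into 𝒯 a and a + 𝒯′ b + (1 + x) b, where 𝒯′ is the operator one degree lower (𝒯 = 𝒯′ + x).
-- Both parts are palindromic, so x^d A_n(1/x) = a + x b is the symmetric decomposition, which is
-- therefore bi-γ-positive. γ-positive polynomials are unimodal, and comparing f_i = a_i + b_i with
-- f_(d−i) = a_i + b_(i−1) and f_(d−1−i) = a_(i+1) + b_i gives the spiral inequalities.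

open import Defs
open import Data.Nat using (ℕ; _≤_; _<_; _∸_)
open import Data.Product using (_×_)
open import Relation.Binary.PropositionalEquality using (_≡_; _≢_)

module Binomial where

  open import Data.Nat using (zero; suc; _+_; _*_; z≤n; s≤s; s≤s⁻¹; _≤ᵇ_)
  open import Data.Nat.Properties
  open import Data.Nat.Combinatorics using (_C_; nCk+nC[k+1]≡[n+1]C[k+1]; nCk≡nC[n∸k]; k>n⇒nCk≡0; nC1≡n)
  open import Data.Bool using (if_then_else_)
  open import Data.Sum using (inj₁; inj₂)
  open import Relation.Binary.PropositionalEquality
  import Data.Nat.Tactic.RingSolver as ℕ-Solver

  pascal : ∀ n k → suc n C suc k ≡ n C k + n C suc k
  pascal n k = sym (nCk+nC[k+1]≡[n+1]C[k+1] n k)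

  [1+k]*[1+n]C[1+k]≡[1+n]*nCk : ∀ n k → suc k * (suc n C suc k) ≡ suc n * (n C k)
  [1+k]*[1+n]C[1+k]≡[1+n]*nCk zero    zero    = refl
  [1+k]*[1+n]C[1+k]≡[1+n]*nCk zero    (suc k) =
    trans (cong ((2 + k) *_) (k>n⇒nCk≡0 (s≤s (s≤s (z≤n {k}))))) (*-zeroʳ (2 + k))
  [1+k]*[1+n]C[1+k]≡[1+n]*nCk (suc n) zero    =
    trans (+-identityʳ _) (trans (nC1≡n (2 + n)) (sym (*-identityʳ (2 + n))))
  [1+k]*[1+n]C[1+k]≡[1+n]*nCk (suc n) (suc k) = begin
    (2 + k) * ((2 + n) C (2 + k))
      ≡⟨ cong ((2 + k) *_) (pascal (suc n) (suc k)) ⟩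
    (2 + k) * (A + B)
      ≡⟨ split k A B ⟩
    (1 + k) * A + (2 + k) * B + A
      ≡⟨ cong₂ (λ u v → u + v + A) ([1+k]*[1+n]C[1+k]≡[1+n]*nCk n k)
                                   ([1+k]*[1+n]C[1+k]≡[1+n]*nCk n (suc k)) ⟩
    (1 + n) * (n C k) + (1 + n) * (n C suc k) + A
      ≡⟨ cong ((1 + n) * (n C k) + (1 + n) * (n C suc k) +_) (pascal n k) ⟩
    (1 + n) * (n C k) + (1 + n) * (n C suc k) + (n C k + n C suc k)
      ≡⟨ merge n (n C k) (n C suc k) ⟩
    (2 + n) * (n C k + n C suc k)
      ≡⟨ cong ((2 + n) *_) (sym (pascal n k)) ⟩
    (2 + n) * (suc n C suc k)
      ∎
    where
    open ≡-Reasoning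
    A = suc n C suc k
    B = suc n C (2 + k)
    split : ∀ k A B → (2 + k) * (A + B) ≡ (1 + k) * A + (2 + k) * B + A
    split = ℕ-Solver.solve-∀
    merge : ∀ n C D → (1 + n) * C + (1 + n) * D + (C + D) ≡ (2 + n) * (C + D)
    merge = ℕ-Solver.solve-∀

  [1+k]*nC[1+k]+k*nCk≡n*nCk : ∀ n k → suc k * (n C suc k) + k * (n C k) ≡ n * (n C k)
  [1+k]*nC[1+k]+k*nCk≡n*nCk zero    zero    = refl
  [1+k]*nC[1+k]+k*nCk≡n*nCk zero    (suc k) = cong₂ _+_ (*-zeroʳ (2 + k)) (*-zeroʳ (1 + k))
  [1+k]*nC[1+k]+k*nCk≡n*nCk (suc n) zero    =
    trans (+-identityʳ _) (trans (+-identityʳ _) (trans (nC1≡n (suc n)) (sym (*-identityʳ (suc n)))))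
  [1+k]*nC[1+k]+k*nCk≡n*nCk (suc n) (suc k) = begin
    (2 + k) * (suc n C (2 + k)) + (1 + k) * (suc n C suc k)
      ≡⟨ cong₂ _+_ ([1+k]*[1+n]C[1+k]≡[1+n]*nCk n (suc k)) ([1+k]*[1+n]C[1+k]≡[1+n]*nCk n k) ⟩
    (1 + n) * (n C suc k) + (1 + n) * (n C k)
      ≡⟨ sym (*-distribˡ-+ (1 + n) (n C suc k) (n C k)) ⟩
    (1 + n) * (n C suc k + n C k)
      ≡⟨ cong ((1 + n) *_) (trans (+-comm (n C suc k) (n C k)) (sym (pascal n k))) ⟩
    (1 + n) * (suc n C suc k)
      ∎
    where open ≡-Reasoning

  nCk≤nC[1+k] : ∀ n k → 2 * k + 1 ≤ n → n C k ≤ n C suc k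
  nCk≤nC[1+k] n k 2k+1≤n =
    *-cancelˡ-≤ (suc k) (+-cancelʳ-≤ (k * (n C k)) (suc k * (n C k)) (suc k * (n C suc k)) (begin
      suc k * (n C k) + k * (n C k)         ≡⟨ sym (*-distribʳ-+ (n C k) (suc k) k) ⟩
      (suc k + k) * (n C k)                 ≤⟨ *-monoˡ-≤ (n C k) (≤-trans (≤-reflexive (twice k)) 2k+1≤n) ⟩
      n * (n C k)                           ≡⟨ sym ([1+k]*nC[1+k]+k*nCk≡n*nCk n k) ⟩
      suc k * (n C suc k) + k * (n C k)     ∎))
    where
    open ≤-Reasoning
    twice : ∀ k → suc k + k ≡ 2 * k + 1
    twice = ℕ-Solver.solve-∀

  xᵏ[1+x]ᵉ : ℕ → ℕ → ℕ → ℕ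
  xᵏ[1+x]ᵉ zero    e i       = e C i
  xᵏ[1+x]ᵉ (suc k) e zero    = 0
  xᵏ[1+x]ᵉ (suc k) e (suc i) = xᵏ[1+x]ᵉ k e i

  xᵏ[1+x]ᵉ≡gammaBasisCoeff : ∀ m k i → xᵏ[1+x]ᵉ k (m ∸ 2 * k) i ≡ gammaBasisCoeff m k i
  xᵏ[1+x]ᵉ≡gammaBasisCoeff m k i = closed-form k (m ∸ 2 * k) i
    where
    ≤ᵇ-suc : ∀ k i → (suc k ≤ᵇ suc i) ≡ (k ≤ᵇ i)
    ≤ᵇ-suc zero    i = refl
    ≤ᵇ-suc (suc k) i = refl
    closed-form : ∀ k e i → xᵏ[1+x]ᵉ k e i ≡ (if k ≤ᵇ i then e C (i ∸ k) else 0)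
    closed-form zero    e i       = refl
    closed-form (suc k) e zero    = refl
    closed-form (suc k) e (suc i) rewrite ≤ᵇ-suc k i = closed-form k e i

  xᵏ[1+x]ᵉ-pascal₀ : ∀ k e → xᵏ[1+x]ᵉ k (suc e) 0 ≡ xᵏ[1+x]ᵉ k e 0
  xᵏ[1+x]ᵉ-pascal₀ zero    e = refl
  xᵏ[1+x]ᵉ-pascal₀ (suc k) e = refl

  xᵏ[1+x]ᵉ-pascal : ∀ k e i → xᵏ[1+x]ᵉ k (suc e) (suc i) ≡ xᵏ[1+x]ᵉ k e (suc i) + xᵏ[1+x]ᵉ k e i
  xᵏ[1+x]ᵉ-pascal zero    e i       = trans (pascal e i) (+-comm (e C i) (e C suc i))
  xᵏ[1+x]ᵉ-pascal (suc k) e zero    = trans (xᵏ[1+x]ᵉ-pascal₀ k e) (sym (+-identityʳ _))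
  xᵏ[1+x]ᵉ-pascal (suc k) e (suc i) = xᵏ[1+x]ᵉ-pascal k e i

  xᵏ[1+x]ᵉ-vanishes : ∀ k e i → k + e < i → xᵏ[1+x]ᵉ k e i ≡ 0
  xᵏ[1+x]ᵉ-vanishes zero    e i       e<i         = k>n⇒nCk≡0 e<i
  xᵏ[1+x]ᵉ-vanishes (suc k) e (suc i) (s≤s k+e<i) = xᵏ[1+x]ᵉ-vanishes k e i k+e<i

  2[1+k]+e≡2+2k+e : ∀ k e → 2 * suc k + e ≡ 2 + (2 * k + e)
  2[1+k]+e≡2+2k+e = ℕ-Solver.solve-∀

  k+e≤2k+e : ∀ k e → k + e ≤ 2 * k + e
  k+e≤2k+e k e = +-monoˡ-≤ e (m≤n*m k 2)

  xᵏ[1+x]ᵉ-palindromic : ∀ k e D i → D ≡ 2 * k + e → i ≤ D → xᵏ[1+x]ᵉ k e (D ∸ i) ≡ xᵏ[1+x]ᵉ k e i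
  xᵏ[1+x]ᵉ-palindromic zero    e D i refl i≤e = sym (nCk≡nC[n∸k] i≤e)
  xᵏ[1+x]ᵉ-palindromic (suc k) e D i D≡  i≤D rewrite trans D≡ (2[1+k]+e≡2+2k+e k e) = shifted i i≤D
    where
    beyond : xᵏ[1+x]ᵉ k e (suc (2 * k + e)) ≡ 0
    beyond = xᵏ[1+x]ᵉ-vanishes k e (suc (2 * k + e)) (s≤s (k+e≤2k+e k e))
    shifted : ∀ i → i ≤ 2 + (2 * k + e) → xᵏ[1+x]ᵉ (suc k) e (2 + (2 * k + e) ∸ i) ≡ xᵏ[1+x]ᵉ (suc k) e i
    shifted zero    _   = beyond
    shifted (suc i) i≤D with m≤n⇒m<n∨m≡n (s≤s⁻¹ i≤D)
    ... | inj₂ refl rewrite n∸n≡0 (2 * k + e) = sym beyond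
    ... | inj₁ i<D  rewrite +-∸-assoc 1 (s≤s⁻¹ i<D) =
      xᵏ[1+x]ᵉ-palindromic k e (2 * k + e) i refl (s≤s⁻¹ i<D)

  xᵏ[1+x]ᵉ-unimodal : ∀ k e D i → D ≡ 2 * k + e → 2 * i + 2 ≤ D → xᵏ[1+x]ᵉ k e i ≤ xᵏ[1+x]ᵉ k e (suc i)
  xᵏ[1+x]ᵉ-unimodal zero    e D i       refl 2i+2≤e =
    nCk≤nC[1+k] e i (≤-trans (+-monoʳ-≤ (2 * i) (s≤s z≤n)) 2i+2≤e)
  xᵏ[1+x]ᵉ-unimodal (suc k) e D zero    D≡   _      = z≤n
  xᵏ[1+x]ᵉ-unimodal (suc k) e D (suc i) D≡   2i+4≤D rewrite trans D≡ (2[1+k]+e≡2+2k+e k e) =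
    xᵏ[1+x]ᵉ-unimodal k e (2 * k + e) i refl
      (s≤s⁻¹ (s≤s⁻¹ (≤-trans (≤-reflexive (sym (2[1+i]+2≡2+2i+2 i))) 2i+4≤D)))
    where
    2[1+i]+2≡2+2i+2 : ∀ i → 2 * suc i + 2 ≡ 2 + (2 * i + 2)
    2[1+i]+2≡2+2i+2 = ℕ-Solver.solve-∀

module BigAscents where

  open import Data.Nat using (zero; suc; _+_; _*_; z≤n; s≤s; s≤s⁻¹; _≤ᵇ_; _≡ᵇ_; _≟_)
  open import Data.Nat.Properties
  open import Data.Bool using (Bool; true; false; if_then_else_; _∧_; not; T)
  open import Data.Unit using (tt)
  open import Data.Empty using (⊥-elim)
  open import Data.List using (List; []; _∷_; _++_; map; filter; length; concatMap)
  open import Data.List.Properties using (map-++; map-cong; map-∘)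
  open import Data.List.Relation.Unary.All as All using (All; []; _∷_)
  open import Data.List.Relation.Unary.All.Properties using (map⁺; concat⁺)
  open import Data.Product using (_,_)
  open import Relation.Binary.PropositionalEquality
  open import Relation.Nullary using (yes; no)
  open import Relation.Nullary.Reflects using (ofʸ; ofⁿ)
  import Data.Nat.Tactic.RingSolver as ℕ-Solver

  ≤ᵇ-true : ∀ {m n} → m ≤ n → (m ≤ᵇ n) ≡ true
  ≤ᵇ-true {m} {n} m≤n with m ≤ᵇ n | ≤ᵇ-reflects-≤ m n
  ... | true  | _       = refl
  ... | false | ofⁿ m≰n = ⊥-elim (m≰n m≤n)

  ≤ᵇ-false : ∀ {m n} → n < m → (m ≤ᵇ n) ≡ false
  ≤ᵇ-false {m} {n} n<m with m ≤ᵇ n | ≤ᵇ-reflects-≤ m n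
  ... | false | _       = refl
  ... | true  | ofʸ m≤n = ⊥-elim (<⇒≱ n<m m≤n)

  boolToℕ : Bool → ℕ
  boolToℕ b = if b then 1 else 0

  δ : ℕ → ℕ → ℕ
  δ b k = boolToℕ (b ≡ᵇ k)

  δ-refl : ∀ k → δ k k ≡ 1
  δ-refl zero    = refl
  δ-refl (suc k) = δ-refl k

  δ-≢ : ∀ {b k} → b ≢ k → δ b k ≡ 0
  δ-≢ {b} {k} b≢k with b ≡ᵇ k in b≡ᵇk
  ... | false = refl
  ... | true  = ⊥-elim (b≢k (≡ᵇ⇒≡ b k (subst T (sym b≡ᵇk) tt)))

  δ-weight : ∀ (f : ℕ → ℕ) b k → δ b k * f b ≡ f k * δ b k
  δ-weight f b k with b ≡ᵇ k in b≡ᵇk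
  ... | false = sym (*-zeroʳ (f k))
  ... | true with refl ← ≡ᵇ⇒≡ b k (subst T (sym b≡ᵇk) tt) = trans (+-identityʳ (f b)) (sym (*-identityʳ (f b)))

  multiplicity : ℕ → List ℕ → ℕ
  multiplicity k []       = 0
  multiplicity k (b ∷ bs) = δ b k + multiplicity k bs

  multiplicity-++ : ∀ k bs cs → multiplicity k (bs ++ cs) ≡ multiplicity k bs + multiplicity k cs
  multiplicity-++ k []       cs = refl
  multiplicity-++ k (b ∷ bs) cs = trans (cong (δ b k +_) (multiplicity-++ k bs cs)) (sym (+-assoc (δ b k) _ _))

  multiplicity-0-suc : ∀ bs → multiplicity 0 (map suc bs) ≡ 0
  multiplicity-0-suc []       = refl
  multiplicity-0-suc (b ∷ bs) = multiplicity-0-suc bs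

  multiplicity-suc-suc : ∀ k bs → multiplicity (suc k) (map suc bs) ≡ multiplicity k bs
  multiplicity-suc-suc k []       = refl
  multiplicity-suc-suc k (b ∷ bs) = cong (δ b k +_) (multiplicity-suc-suc k bs)

  multiplicity-< : ∀ {x} bs → All (_< x) bs → multiplicity x bs ≡ 0
  multiplicity-< []       []           = refl
  multiplicity-< (b ∷ bs) (b<x ∷ bs<x) = cong₂ _+_ (δ-≢ (<⇒≢ b<x)) (multiplicity-< bs bs<x)

  A-coeff≡multiplicity : ∀ n k → A-coeff n k ≡ multiplicity k (map basc (perms n))
  A-coeff≡multiplicity n k = count (perms n)
    where
    count : ∀ L → length (filter (λ π → basc π ≟ k) L) ≡ multiplicity k (map basc L)
    count []      = refl
    count (σ ∷ L) with basc σ ≡ᵇ k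
    ... | true  = cong suc (count L)
    ... | false = count L

  -- Inserting x, larger than every letter, between y and z replaces the step y → z by y → x → z,
  -- and x → z is never a big ascent; so basc grows by one exactly when y → x is a big ascent
  -- and y → z was not. ascentGains x y ys lists this for the slot after each letter of y ∷ ys.
  ascentGains : ℕ → ℕ → List ℕ → List Bool
  ascentGains x y []       = (y + 2 ≤ᵇ x) ∷ []
  ascentGains x y (z ∷ zs) = ((y + 2 ≤ᵇ x) ∧ not (y + 2 ≤ᵇ z)) ∷ ascentGains x z zs

  basc-insert-before : ∀ x y z zs → z < x →
    basc (y ∷ x ∷ z ∷ zs) ≡ boolToℕ ((y + 2 ≤ᵇ x) ∧ not (y + 2 ≤ᵇ z)) + basc (y ∷ z ∷ zs)
  basc-insert-before x y z zs z<x
    rewrite ≤ᵇ-false {x + 2} {z} (≤-trans z<x (m≤m+n x 2))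
    with y + 2 ≤ᵇ x | ≤ᵇ-reflects-≤ (y + 2) x | y + 2 ≤ᵇ z | ≤ᵇ-reflects-≤ (y + 2) z
  ... | true  | _         | true  | _         = refl
  ... | true  | _         | false | _         = refl
  ... | false | _         | false | _         = refl
  ... | false | ofⁿ y+2≰x | true  | ofʸ y+2≤z = ⊥-elim (y+2≰x (≤-trans y+2≤z (<⇒≤ z<x)))

  basc-insertions-after : ∀ x y ys → All (_< x) (y ∷ ys) →
    map basc (map (y ∷_) (insertions x ys)) ≡ map (λ g → boolToℕ g + basc (y ∷ ys)) (ascentGains x y ys)
  basc-insertions-after x y []       _                   = refl
  basc-insertions-after x y (z ∷ zs) (_ ∷ all@(z<x ∷ _)) =
    cong₂ _∷_ (basc-insert-before x y z zs z<x) (begin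
      map basc (map (y ∷_) (map (z ∷_) (insertions x zs)))
        ≡⟨ prepend (insertions x zs) ⟩
      map (c +_) (map basc (map (z ∷_) (insertions x zs)))
        ≡⟨ cong (map (c +_)) (basc-insertions-after x z zs all) ⟩
      map (c +_) (map (λ g → boolToℕ g + basc (z ∷ zs)) (ascentGains x z zs))
        ≡⟨ sym (map-∘ (ascentGains x z zs)) ⟩
      map (λ g → c + (boolToℕ g + basc (z ∷ zs))) (ascentGains x z zs)
        ≡⟨ map-cong (λ g → x+[y+z]≡y+[x+z] c (boolToℕ g) (basc (z ∷ zs))) (ascentGains x z zs) ⟩
      map (λ g → boolToℕ g + (c + basc (z ∷ zs))) (ascentGains x z zs)
        ∎)
    where
    open ≡-Reasoning
    c = boolToℕ (y + 2 ≤ᵇ z)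
    prepend : ∀ L → map basc (map (y ∷_) (map (z ∷_) L)) ≡ map (c +_) (map basc (map (z ∷_) L))
    prepend []      = refl
    prepend (_ ∷ L) = cong (_ ∷_) (prepend L)
    x+[y+z]≡y+[x+z] : ∀ x y z → x + (y + z) ≡ y + (x + z)
    x+[y+z]≡y+[x+z] = ℕ-Solver.solve-∀

  trues falses : List Bool → ℕ
  trues  []       = 0
  trues  (g ∷ gs) = boolToℕ g + trues gs
  falses []       = 0
  falses (g ∷ gs) = boolToℕ (not g) + falses gs

  falses+trues≡length : ∀ gs → falses gs + trues gs ≡ length gs
  falses+trues≡length []           = refl
  falses+trues≡length (true  ∷ gs) = trans (+-suc (falses gs) (trues gs)) (cong suc (falses+trues≡length gs))
  falses+trues≡length (false ∷ gs) = cong suc (falses+trues≡length gs)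

  length-ascentGains : ∀ x y ys → length (ascentGains x y ys) ≡ length (y ∷ ys)
  length-ascentGains x y []       = refl
  length-ascentGains x y (z ∷ zs) = cong suc (length-ascentGains x z zs)

  multiplicity-raised : ∀ k b gs →
    multiplicity k (map (λ g → boolToℕ g + b) gs) ≡ δ b k * falses gs + δ (suc b) k * trues gs
  multiplicity-raised k b []           = sym (cong₂ _+_ (*-zeroʳ (δ b k)) (*-zeroʳ (δ (suc b) k)))
  multiplicity-raised k b (true  ∷ gs) =
    trans (cong (δ (suc b) k +_) (multiplicity-raised k b gs)) (raise (δ b k) (δ (suc b) k) (falses gs) (trues gs))
    where
    raise : ∀ d d′ f t → d′ + (d * f + d′ * t) ≡ d * (0 + f) + d′ * (1 + t)
    raise = ℕ-Solver.solve-∀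
  multiplicity-raised k b (false ∷ gs) =
    trans (cong (δ b k +_) (multiplicity-raised k b gs)) (keep (δ b k) (δ (suc b) k) (falses gs) (trues gs))
    where
    keep : ∀ d d′ f t → d + (d * f + d′ * t) ≡ d * (1 + f) + d′ * (0 + t)
    keep = ℕ-Solver.solve-∀

  gain+ascent≡ascent : ∀ x y z → z < x →
    boolToℕ ((y + 2 ≤ᵇ x) ∧ not (y + 2 ≤ᵇ z)) + boolToℕ (y + 2 ≤ᵇ z) ≡ boolToℕ (y + 2 ≤ᵇ x)
  gain+ascent≡ascent x y z z<x with y + 2 ≤ᵇ x | ≤ᵇ-reflects-≤ (y + 2) x | y + 2 ≤ᵇ z | ≤ᵇ-reflects-≤ (y + 2) z
  ... | true  | _         | true  | _         = refl
  ... | true  | _         | false | _         = refl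
  ... | false | _         | false | _         = refl
  ... | false | ofⁿ y+2≰x | true  | ofʸ y+2≤z = ⊥-elim (y+2≰x (≤-trans y+2≤z (<⇒≤ z<x)))

  ascent-to-top+δ≡1 : ∀ {n y} → y < suc n → boolToℕ (y + 2 ≤ᵇ suc n) + δ y n ≡ 1
  ascent-to-top+δ≡1 {n} {y} y<1+n with y ≟ n
  ... | yes refl rewrite ≤ᵇ-false {y + 2} {suc y} (≤-reflexive (+-comm 2 y)) | δ-refl y = refl
  ... | no  y≢n  rewrite ≤ᵇ-true (≤-trans (≤-reflexive (+-comm y 2)) (s≤s (≤∧≢⇒< (s≤s⁻¹ y<1+n) y≢n)))
                       | δ-≢ y≢n = refl

  trues-ascentGains : ∀ n y ys → All (_< suc n) (y ∷ ys) →
    trues (ascentGains (suc n) y ys) + basc (y ∷ ys) + multiplicity n (y ∷ ys) ≡ length (y ∷ ys)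
  trues-ascentGains n y []       (y<1+n ∷ []) =
    trans (regroup (boolToℕ (y + 2 ≤ᵇ suc n)) (δ y n)) (ascent-to-top+δ≡1 y<1+n)
    where
    regroup : ∀ a d → a + 0 + 0 + (d + 0) ≡ a + d
    regroup = ℕ-Solver.solve-∀
  trues-ascentGains n y (z ∷ zs) (y<1+n ∷ all@(z<1+n ∷ _)) = begin
    (g + t) + (c + b) + (d + m)
      ≡⟨ regroup g t c b d m ⟩
    (g + c) + d + (t + b + m)
      ≡⟨ cong₂ (λ u v → u + d + v) (gain+ascent≡ascent (suc n) y z z<1+n) (trues-ascentGains n z zs all) ⟩
    boolToℕ (y + 2 ≤ᵇ suc n) + d + length (z ∷ zs)
      ≡⟨ cong (_+ length (z ∷ zs)) (ascent-to-top+δ≡1 y<1+n) ⟩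
    suc (length (z ∷ zs))
      ∎
    where
    open ≡-Reasoning
    g = boolToℕ ((y + 2 ≤ᵇ suc n) ∧ not (y + 2 ≤ᵇ z))
    t = trues (ascentGains (suc n) z zs)
    c = boolToℕ (y + 2 ≤ᵇ z)
    b = basc (z ∷ zs)
    d = δ y n
    m = multiplicity n (z ∷ zs)
    regroup : ∀ g t c b d m → (g + t) + (c + b) + (d + m) ≡ (g + c) + d + (t + b + m)
    regroup = ℕ-Solver.solve-∀

  -- What the insertion step uses about a permutation σ of {0, …, n}.
  PermLike : ℕ → List ℕ → Set
  PermLike n σ = All (_< suc n) σ × multiplicity n σ ≡ 1 × length σ ≡ suc n

  multiplicity-basc-insertions : ∀ n σ k → PermLike n σ →
    multiplicity k (map basc (insertions (suc n) σ)) ≡ (2 + k) * δ (basc σ) k + (suc n ∸ k) * δ (suc (basc σ)) k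
  multiplicity-basc-insertions n (y ∷ ys) k (all@(y<1+n ∷ _) , top-once , length≡) = begin
    δ (basc (suc n ∷ y ∷ ys)) k + multiplicity k (map basc (map (y ∷_) (insertions (suc n) ys)))
      ≡⟨ cong₂ (λ u v → δ u k + multiplicity k v) front (basc-insertions-after (suc n) y ys all) ⟩
    δ b k + multiplicity k (map (λ g → boolToℕ g + b) gs)
      ≡⟨ cong (δ b k +_) (multiplicity-raised k b gs) ⟩
    δ b k + (δ b k * falses gs + δ (suc b) k * trues gs)
      ≡⟨ regroup (δ b k) (δ (suc b) k) (falses gs) (trues gs) ⟩
    δ b k * (1 + falses gs) + δ (suc b) k * trues gs
      ≡⟨ cong₂ (λ f t → δ b k * (1 + f) + δ (suc b) k * t) falses≡1+b trues≡n∸b ⟩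
    δ b k * (2 + b) + δ (suc b) k * (suc n ∸ suc b)
      ≡⟨ cong₂ _+_ (δ-weight (2 +_) b k) (δ-weight (suc n ∸_) (suc b) k) ⟩
    (2 + k) * δ b k + (suc n ∸ k) * δ (suc b) k
      ∎
    where
    open ≡-Reasoning
    b = basc (y ∷ ys)
    gs = ascentGains (suc n) y ys
    front : basc (suc n ∷ y ∷ ys) ≡ b
    front rewrite ≤ᵇ-false {suc n + 2} {y} (≤-trans y<1+n (m≤m+n (suc n) 2)) = refl
    regroup : ∀ d d′ f t → d + (d * f + d′ * t) ≡ d * (1 + f) + d′ * t
    regroup = ℕ-Solver.solve-∀
    trues+1+b≡1+n : trues gs + suc b ≡ suc n
    trues+1+b≡1+n = begin
      trues gs + suc b                         ≡⟨ +-suc (trues gs) b ⟩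
      suc (trues gs + b)                       ≡⟨ +-comm 1 (trues gs + b) ⟩
      trues gs + b + 1                         ≡⟨ cong (trues gs + b +_) (sym top-once) ⟩
      trues gs + b + multiplicity n (y ∷ ys)   ≡⟨ trues-ascentGains n y ys all ⟩
      length (y ∷ ys)                          ≡⟨ length≡ ⟩
      suc n                                    ∎
    trues≡n∸b : trues gs ≡ suc n ∸ suc b
    trues≡n∸b = trans (sym (m+n∸n≡m (trues gs) (suc b))) (cong (_∸ suc b) trues+1+b≡1+n)
    falses≡1+b : falses gs ≡ suc b
    falses≡1+b = +-cancelʳ-≡ (trues gs) (falses gs) (suc b) (begin
      falses gs + trues gs    ≡⟨ falses+trues≡length gs ⟩
      length gs               ≡⟨ trans (length-ascentGains (suc n) y ys) length≡ ⟩
      suc n                   ≡⟨ sym trues+1+b≡1+n ⟩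
      trues gs + suc b        ≡⟨ +-comm (trues gs) (suc b) ⟩
      suc b + trues gs        ∎)

  multiplicity-basc-concatMap-insertions : ∀ n k L → All (PermLike n) L →
    multiplicity k (map basc (concatMap (insertions (suc n)) L)) ≡
      (2 + k) * multiplicity k (map basc L) + (suc n ∸ k) * multiplicity k (map suc (map basc L))
  multiplicity-basc-concatMap-insertions n k []      []            =
    sym (cong₂ _+_ (*-zeroʳ (2 + k)) (*-zeroʳ (suc n ∸ k)))
  multiplicity-basc-concatMap-insertions n k (σ ∷ L) (σ-ok ∷ L-ok) = begin
    multiplicity k (map basc (insertions (suc n) σ ++ rest))
      ≡⟨ cong (multiplicity k) (map-++ basc (insertions (suc n) σ) rest) ⟩
    multiplicity k (map basc (insertions (suc n) σ) ++ map basc rest)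
      ≡⟨ multiplicity-++ k (map basc (insertions (suc n) σ)) (map basc rest) ⟩
    multiplicity k (map basc (insertions (suc n) σ)) + multiplicity k (map basc rest)
      ≡⟨ cong₂ _+_ (multiplicity-basc-insertions n σ k σ-ok) (multiplicity-basc-concatMap-insertions n k L L-ok) ⟩
    ((2 + k) * δ (basc σ) k + (suc n ∸ k) * δ (suc (basc σ)) k) +
    ((2 + k) * multiplicity k (map basc L) + (suc n ∸ k) * multiplicity k (map suc (map basc L)))
      ≡⟨ collect (2 + k) (suc n ∸ k) (δ (basc σ) k) (δ (suc (basc σ)) k) _ _ ⟩
    (2 + k) * multiplicity k (map basc (σ ∷ L)) + (suc n ∸ k) * multiplicity k (map suc (map basc (σ ∷ L)))
      ∎
    where
    open ≡-Reasoning
    rest = concatMap (insertions (suc n)) L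
    collect : ∀ a c x y X Y → (a * x + c * y) + (a * X + c * Y) ≡ a * (x + X) + c * (y + Y)
    collect = ℕ-Solver.solve-∀

  insertions-PermLike : ∀ x τ → All (_< x) τ →
    All (λ σ → All (_< suc x) σ × multiplicity x σ ≡ 1 × length σ ≡ suc (length τ)) (insertions x τ)
  insertions-PermLike x []       []                = ((n<1+n x ∷ []) , cong (_+ 0) (δ-refl x) , refl) ∷ []
  insertions-PermLike x (y ∷ ys) all@(y<x ∷ ys<x) =
    ((n<1+n x ∷ All.map m<n⇒m<1+n all) , cong₂ _+_ (δ-refl x) (multiplicity-< (y ∷ ys) all) , refl)
    ∷ map⁺ (All.map (λ (σ<1+x , once , length≡) →
                       (m<n⇒m<1+n y<x ∷ σ<1+x) , trans (cong (_+ _) (δ-≢ (<⇒≢ y<x))) once , cong suc length≡)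
                    (insertions-PermLike x ys ys<x))

  perms-PermLike : ∀ n → All (PermLike n) (perms (suc n))
  perms-PermLike zero    = ((s≤s z≤n ∷ []) , refl , refl) ∷ []
  perms-PermLike (suc n) = concat⁺ (map⁺ (All.map extend (perms-PermLike n)))
    where
    extend : ∀ {τ} → PermLike n τ → All (PermLike (suc n)) (insertions (suc n) τ)
    extend (τ<1+n , _ , length≡) =
      All.map (λ (σ<2+n , once , length≡′) → σ<2+n , once , trans length≡′ (cong suc length≡))
              (insertions-PermLike (suc n) _ τ<1+n)

  A-coeff-recurrence₀ : ∀ n → A-coeff (2 + n) 0 ≡ 2 * A-coeff (1 + n) 0
  A-coeff-recurrence₀ n = begin
    A-coeff (2 + n) 0
      ≡⟨ A-coeff≡multiplicity (2 + n) 0 ⟩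
    multiplicity 0 (map basc (concatMap (insertions (suc n)) (perms (suc n))))
      ≡⟨ multiplicity-basc-concatMap-insertions n 0 (perms (suc n)) (perms-PermLike n) ⟩
    2 * multiplicity 0 bs + suc n * multiplicity 0 (map suc bs)
      ≡⟨ cong₂ (λ u v → 2 * u + suc n * v) (sym (A-coeff≡multiplicity (1 + n) 0)) (multiplicity-0-suc bs) ⟩
    2 * A-coeff (1 + n) 0 + suc n * 0
      ≡⟨ trans (cong (2 * A-coeff (1 + n) 0 +_) (*-zeroʳ (suc n))) (+-identityʳ _) ⟩
    2 * A-coeff (1 + n) 0
      ∎
    where
    open ≡-Reasoning
    bs = map basc (perms (suc n))

  A-coeff-recurrence : ∀ n k → A-coeff (2 + n) (suc k) ≡ (3 + k) * A-coeff (1 + n) (suc k) + (n ∸ k) * A-coeff (1 + n) k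
  A-coeff-recurrence n k = begin
    A-coeff (2 + n) (suc k)
      ≡⟨ A-coeff≡multiplicity (2 + n) (suc k) ⟩
    multiplicity (suc k) (map basc (concatMap (insertions (suc n)) (perms (suc n))))
      ≡⟨ multiplicity-basc-concatMap-insertions n (suc k) (perms (suc n)) (perms-PermLike n) ⟩
    (3 + k) * multiplicity (suc k) bs + (n ∸ k) * multiplicity (suc k) (map suc bs)
      ≡⟨ cong₂ (λ u v → (3 + k) * u + (n ∸ k) * v) (sym (A-coeff≡multiplicity (1 + n) (suc k)))
               (trans (multiplicity-suc-suc k bs) (sym (A-coeff≡multiplicity (1 + n) k))) ⟩
    (3 + k) * A-coeff (1 + n) (suc k) + (n ∸ k) * A-coeff (1 + n) k
      ∎
    where
    open ≡-Reasoning
    bs = map basc (perms (suc n))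

  A-coeff-vanishes : ∀ m k → m < k → A-coeff (2 + m) k ≡ 0
  A-coeff-vanishes zero    (suc k) _         = refl
  A-coeff-vanishes (suc m) (suc k) (s≤s m<k) = begin
    A-coeff (3 + m) (suc k)
      ≡⟨ A-coeff-recurrence (suc m) k ⟩
    (3 + k) * A-coeff (2 + m) (suc k) + (suc m ∸ k) * A-coeff (2 + m) k
      ≡⟨ cong₂ (λ u v → (3 + k) * u + (suc m ∸ k) * v)
               (A-coeff-vanishes m (suc k) (m<n⇒m<1+n m<k)) (A-coeff-vanishes m k m<k) ⟩
    (3 + k) * 0 + (suc m ∸ k) * 0
      ≡⟨ cong₂ _+_ (*-zeroʳ (3 + k)) (*-zeroʳ (suc m ∸ k)) ⟩
    0
      ∎
    where open ≡-Reasoning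

  A-coeff-constant≢0 : ∀ m → A-coeff (2 + m) 0 ≢ 0
  A-coeff-constant≢0 zero    ()
  A-coeff-constant≢0 (suc m) A≡0 =
    A-coeff-constant≢0 m (m+n≡0⇒m≡0 (A-coeff (2 + m) 0) (trans (sym (A-coeff-recurrence₀ (suc m))) A≡0))

  A-coeff-leading≢0 : ∀ m → A-coeff (2 + m) m ≢ 0
  A-coeff-leading≢0 zero    ()
  A-coeff-leading≢0 (suc m) A≡0 = A-coeff-leading≢0 m (trans (sym leading) A≡0)
    where
    open ≡-Reasoning
    leading : A-coeff (3 + m) (suc m) ≡ A-coeff (2 + m) m
    leading = begin
      A-coeff (3 + m) (suc m)
        ≡⟨ A-coeff-recurrence (suc m) m ⟩
      (3 + m) * A-coeff (2 + m) (suc m) + (suc m ∸ m) * A-coeff (2 + m) m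
        ≡⟨ cong₂ (λ u v → (3 + m) * u + v * A-coeff (2 + m) m)
                 (A-coeff-vanishes m (suc m) (n<1+n m)) (m+n∸n≡m 1 m) ⟩
      (3 + m) * 0 + 1 * A-coeff (2 + m) m
        ≡⟨ cong₂ _+_ (*-zeroʳ (3 + m)) (*-identityˡ (A-coeff (2 + m) m)) ⟩
      A-coeff (2 + m) m
        ∎

module CoefficientSequences where

  open import Data.Nat as ℕ using (zero; suc; z≤n; s≤s; s≤s⁻¹)
  import Data.Nat.Properties as ℕ
  open import Data.Integer as ℤ using (ℤ; +_; _+_; _*_; _-_)
  open import Data.Integer.Properties using (pos-+)
  import Data.Integer.Properties as ℤ
  open import Data.Integer.Tactic.RingSolver using (solve-∀)
  open import Algebra.Properties.CommutativeSemigroup ℤ.+-commutativeSemigroup using (interchange)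
  open import Data.List using (map; applyUpTo)
  open import Data.Product using (_,_)
  open import Data.Sum using (inj₁; inj₂)
  open import Relation.Binary.PropositionalEquality
  open import Relation.Nullary using (yes; no)
  open import Data.Bool using (true; false)
  open BigAscents using (≤ᵇ-true; ≤ᵇ-false)

  Coeffs : Set
  Coeffs = ℕ → ℤ

  shift : Coeffs → Coeffs
  shift q zero    = + 0
  shift q (suc i) = q i

  shift-* : ∀ c q i → shift (λ j → c * q j) i ≡ c * shift q i
  shift-* c q zero    = sym (ℤ.*-zeroʳ c)
  shift-* c q (suc i) = refl

  ∑ : ℕ → (ℕ → ℤ) → ℤ
  ∑ zero    f = + 0
  ∑ (suc N) f = f 0 + ∑ N (λ k → f (suc k))

  ∑-cong : ∀ N {f g} → (∀ k → f k ≡ g k) → ∑ N f ≡ ∑ N g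
  ∑-cong zero    f≗g = refl
  ∑-cong (suc N) f≗g = cong₂ _+_ (f≗g 0) (∑-cong N (λ k → f≗g (suc k)))

  ∑-0 : ∀ N → ∑ N (λ _ → + 0) ≡ + 0
  ∑-0 zero    = refl
  ∑-0 (suc N) = trans (ℤ.+-identityˡ (∑ N (λ _ → + 0))) (∑-0 N)

  ∑-+ : ∀ N f g → ∑ N (λ k → f k + g k) ≡ ∑ N f + ∑ N g
  ∑-+ zero    f g = refl
  ∑-+ (suc N) f g = trans (cong (_+_ (f 0 + g 0)) (∑-+ N (λ k → f (suc k)) (λ k → g (suc k))))
                          (interchange (f 0) (g 0) (∑ N (λ k → f (suc k))) (∑ N (λ k → g (suc k))))

  ∑-last : ∀ N f → ∑ (suc N) f ≡ ∑ N f + f N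
  ∑-last zero    f = ℤ.+-comm (f 0) (+ 0)
  ∑-last (suc N) f = trans (cong (_+_ (f 0)) (∑-last N (λ k → f (suc k)))) (sym (ℤ.+-assoc (f 0) _ (f (suc N))))

  ∑-truncate : ∀ N M f → N ℕ.≤ M → (∀ k → N ℕ.≤ k → f k ≡ + 0) → ∑ M f ≡ ∑ N f
  ∑-truncate N zero    f z≤n   _      = refl
  ∑-truncate N (suc M) f N≤1+M tail≡0 with ℕ.m≤n⇒m<n∨m≡n N≤1+M
  ... | inj₂ refl  = refl
  ... | inj₁ N<1+M = begin
    ∑ (suc M) f    ≡⟨ ∑-last M f ⟩
    ∑ M f + f M    ≡⟨ cong (_+_ (∑ M f)) (tail≡0 M (s≤s⁻¹ N<1+M)) ⟩
    ∑ M f + + 0    ≡⟨ ℤ.+-identityʳ (∑ M f) ⟩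
    ∑ M f          ≡⟨ ∑-truncate N M f (s≤s⁻¹ N<1+M) tail≡0 ⟩
    ∑ N f          ∎
    where open ≡-Reasoning

  ∑-mono-≤ : ∀ N {f g} → (∀ k → f k ℤ.≤ g k) → ∑ N f ℤ.≤ ∑ N g
  ∑-mono-≤ zero    f≤g = ℤ.≤-refl
  ∑-mono-≤ (suc N) f≤g = ℤ.+-mono-≤ (f≤g 0) (∑-mono-≤ N (λ k → f≤g (suc k)))

  shift-∑ : ∀ N (f : ℕ → Coeffs) i → shift (λ j → ∑ N (λ k → f k j)) i ≡ ∑ N (λ k → shift (f k) i)
  shift-∑ N f zero    = sym (∑-0 N)
  shift-∑ N f (suc i) = refl

  -- 𝒯 d q = (1 + (d + 1) x) q + x (1 − x) q′.
  𝒯 : ℕ → Coeffs → Coeffs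
  𝒯 d q zero    = q zero
  𝒯 d q (suc i) = (+ 2 + + i) * q (suc i) + (+ 1 + + d - + i) * q i

  𝒯-cong : ∀ d {q r} → (∀ j → q j ≡ r j) → ∀ i → 𝒯 d q i ≡ 𝒯 d r i
  𝒯-cong d q≗r zero    = q≗r zero
  𝒯-cong d q≗r (suc i) = cong₂ (λ u v → (+ 2 + + i) * u + (+ 1 + + d - + i) * v) (q≗r (suc i)) (q≗r i)

  𝒯-+ : ∀ d q r i → 𝒯 d (λ j → q j + r j) i ≡ 𝒯 d q i + 𝒯 d r i
  𝒯-+ d q r zero    = refl
  𝒯-+ d q r (suc i) = distrib (+ 2 + + i) (+ 1 + + d - + i) (q (suc i)) (q i) (r (suc i)) (r i)
    where
    distrib : ∀ a b x y x′ y′ → a * (x + x′) + b * (y + y′) ≡ (a * x + b * y) + (a * x′ + b * y′)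
    distrib = solve-∀

  𝒯-* : ∀ d c q i → 𝒯 d (λ j → c * q j) i ≡ c * 𝒯 d q i
  𝒯-* d c q zero    = refl
  𝒯-* d c q (suc i) = commute (+ 2 + + i) (+ 1 + + d - + i) c (q (suc i)) (q i)
    where
    commute : ∀ a b c x y → a * (c * x) + b * (c * y) ≡ c * (a * x + b * y)
    commute = solve-∀

  𝒯-0 : ∀ d i → 𝒯 d (λ _ → + 0) i ≡ + 0
  𝒯-0 d zero    = refl
  𝒯-0 d (suc i) = zeros (+ 2 + + i) (+ 1 + + d - + i)
    where
    zeros : ∀ a b → a * + 0 + b * + 0 ≡ + 0
    zeros = solve-∀

  𝒯-∑ : ∀ d N (f : ℕ → Coeffs) i → 𝒯 d (λ j → ∑ N (λ k → f k j)) i ≡ ∑ N (λ k → 𝒯 d (f k) i)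
  𝒯-∑ d zero    f i = 𝒯-0 d i
  𝒯-∑ d (suc N) f i = trans (𝒯-+ d (f 0) (λ j → ∑ N (λ k → f (suc k) j)) i)
                            (cong (_+_ (𝒯 d (f 0) i)) (𝒯-∑ d N (λ k → f (suc k)) i))

  𝒯-suc : ∀ d q i → 𝒯 (suc d) q i ≡ 𝒯 d q i + shift q i
  𝒯-suc d q zero    = sym (ℤ.+-identityʳ (q zero))
  𝒯-suc d q (suc i) = trans (cong (λ u → (+ 2 + + i) * q (suc i) + (+ 1 + u - + i) * q i) (pos-+ 1 d))
                            (expand (+ 2 + + i) (+ d) (+ i) (q (suc i)) (q i))
    where
    expand : ∀ a d i x y → a * x + (+ 1 + (+ 1 + d) - i) * y ≡ a * x + (+ 1 + d - i) * y + y
    expand = solve-∀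

  𝒯-shift : ∀ d q i → 𝒯 (2 ℕ.+ d) (shift q) (suc i) ≡ 𝒯 d q i + q i + shift q i
  𝒯-shift d q zero    = expand (q zero) (+ 1 + + (2 ℕ.+ d) - + 0)
    where
    expand : ∀ x c → (+ 2 + + 0) * x + c * + 0 ≡ x + x + + 0
    expand = solve-∀
  𝒯-shift d q (suc i) = trans (cong₂ (λ u w → (+ 2 + u) * q (suc i) + (+ 1 + w - u) * q i) (pos-+ 1 i) (pos-+ 2 d))
                              (expand (+ i) (+ d) (q (suc i)) (q i))
    where
    expand : ∀ i d x y → (+ 2 + (+ 1 + i)) * x + (+ 1 + (+ 2 + d) - (+ 1 + i)) * y
                       ≡ (+ 2 + i) * x + (+ 1 + d - i) * y + x + y
    expand = solve-∀

  -- q has degree < m and q(x) = x^(m−1) q(1/x); m − 1 is avoided so that m = 0 forces q = 0.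
  PalindromicBelow : ℕ → Coeffs → Set
  PalindromicBelow m q = (∀ j → j ℕ.< m → q (m ∸ suc j) ≡ q j) × (∀ j → m ℕ.≤ j → q j ≡ + 0)

  revCoeff-≤ : ∀ m q {j} → j ℕ.≤ m → revCoeff m q j ≡ q (m ∸ j)
  revCoeff-≤ m q j≤m rewrite ≤ᵇ-true j≤m = refl

  revCoeff-> : ∀ m q {j} → m ℕ.< j → revCoeff m q j ≡ + 0
  revCoeff-> m q m<j rewrite ≤ᵇ-false m<j = refl

  revCoeff-cong : ∀ m {q r} → (∀ i → q i ≡ r i) → ∀ j → revCoeff m q j ≡ revCoeff m r j
  revCoeff-cong m q≗r j with j ℕ.≤ᵇ m
  ... | true  = q≗r (m ∸ j)
  ... | false = refl

  revCoeff-+ : ∀ m q r j → revCoeff m (λ i → q i + r i) j ≡ revCoeff m q j + revCoeff m r j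
  revCoeff-+ m q r j with j ℕ.≤ᵇ m
  ... | true  = refl
  ... | false = refl

  revCoeff-id : ∀ {d q} → PalindromicBelow (suc d) q → ∀ j → revCoeff d q j ≡ q j
  revCoeff-id {d} {q} (symmetric , degree<) j with j ℕ.≤? d
  ... | yes j≤d = trans (revCoeff-≤ d q j≤d) (symmetric j (s≤s j≤d))
  ... | no  j≰d = trans (revCoeff-> d q (ℕ.≰⇒> j≰d)) (sym (degree< j (ℕ.≰⇒> j≰d)))

  revCoeff-shift : ∀ {m q} → PalindromicBelow m q → ∀ j → revCoeff m q j ≡ shift q j
  revCoeff-shift {m} {q} (symmetric , degree<) zero    = degree< m ℕ.≤-refl
  revCoeff-shift {m} {q} (symmetric , degree<) (suc j) with suc j ℕ.≤? m
  ... | yes j<m = trans (revCoeff-≤ m q j<m) (symmetric j j<m)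
  ... | no  j≮m = trans (revCoeff-> m q (ℕ.≰⇒> j≮m)) (sym (degree< j (s≤s⁻¹ (ℕ.≰⇒> j≮m))))

  revCoeff-involutive : ∀ d q → (∀ j → d ℕ.< j → q j ≡ + 0) → ∀ j → revCoeff d (revCoeff d q) j ≡ q j
  revCoeff-involutive d q degree≤ j with j ℕ.≤? d
  ... | yes j≤d = begin
    revCoeff d (revCoeff d q) j   ≡⟨ revCoeff-≤ d (revCoeff d q) j≤d ⟩
    revCoeff d q (d ∸ j)          ≡⟨ revCoeff-≤ d q (ℕ.m∸n≤m d j) ⟩
    q (d ∸ (d ∸ j))               ≡⟨ cong q (ℕ.m∸[m∸n]≡n j≤d) ⟩
    q j                           ∎
    where open ≡-Reasoning
  ... | no  j≰d = trans (revCoeff-> d (revCoeff d q) (ℕ.≰⇒> j≰d)) (sym (degree≤ j (ℕ.≰⇒> j≰d)))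

  revCoeff-suc : ∀ d q → q (suc d) ≡ + 0 → ∀ j → revCoeff (suc d) q j ≡ shift (revCoeff d q) j
  revCoeff-suc d q q[1+d]≡0 zero    = q[1+d]≡0
  revCoeff-suc d q q[1+d]≡0 (suc j) with j ℕ.≤? d
  ... | yes j≤d = trans (revCoeff-≤ (suc d) q (s≤s j≤d)) (sym (revCoeff-≤ d q j≤d))
  ... | no  j≰d = trans (revCoeff-> (suc d) q (s≤s (ℕ.≰⇒> j≰d))) (sym (revCoeff-> d q (ℕ.≰⇒> j≰d)))

  partialSum-[1-x] : ∀ (a c : Coeffs) → (∀ j → c j ≡ a j - shift a j) → ∀ i → partialSum c i ≡ a i
  partialSum-[1-x] a c c≡[1-x]a i = trans (sumℤ≡∑ (suc i) (λ k → k)) (telescope i)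
    where
    sumℤ≡∑ : ∀ N h → sumℤ (map c (applyUpTo h N)) ≡ ∑ N (λ k → c (h k))
    sumℤ≡∑ zero    h = refl
    sumℤ≡∑ (suc N) h = cong (_+_ (c (h 0))) (sumℤ≡∑ N (λ k → h (suc k)))
    telescope : ∀ i → ∑ (suc i) c ≡ a i
    telescope zero    = trans (ℤ.+-identityʳ (c 0)) (trans (c≡[1-x]a 0) (ℤ.+-identityʳ (a 0)))
    telescope (suc i) = begin
      ∑ (suc (suc i)) c          ≡⟨ ∑-last (suc i) c ⟩
      ∑ (suc i) c + c (suc i)    ≡⟨ cong₂ _+_ (telescope i) (c≡[1-x]a (suc i)) ⟩
      a i + (a (suc i) - a i)    ≡⟨ cancel (a i) (a (suc i)) ⟩
      a (suc i)                  ∎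
      where
      open ≡-Reasoning
      cancel : ∀ x y → x + (y - x) ≡ y
      cancel = solve-∀

module GammaExpansions where

  open Binomial
  open CoefficientSequences
  open import Data.Nat as ℕ using (zero; suc; z≤n; s≤s; s≤s⁻¹)
  import Data.Nat.Properties as ℕ
  open import Data.Nat.Combinatorics using (_C_)
  open import Data.Nat.DivMod using (_/_; _%_; m≡m%n+[m/n]*n; m%n<n; m/n≤m)
  open import Data.Integer as ℤ using (ℤ; +_; _+_; _*_; _-_)
  open import Data.Integer.Properties using (pos-+; pos-*)
  import Data.Integer.Properties as ℤ
  open import Data.Integer.Tactic.RingSolver using (solve-∀)
  open import Data.List using (map; applyUpTo; upTo; foldr)
  open import Data.Product using (_,_)
  open import Data.Sum using (_⊎_; inj₁; inj₂)
  open import Relation.Binary.PropositionalEquality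
  open import Relation.Nullary using (yes; no)

  ℤxᵏ[1+x]ᵉ : ℕ → ℕ → Coeffs
  ℤxᵏ[1+x]ᵉ k e i = + xᵏ[1+x]ᵉ k e i

  ℤxᵏ[1+x]ᵉ-pascal : ∀ k e i → ℤxᵏ[1+x]ᵉ k e i + shift (ℤxᵏ[1+x]ᵉ k e) i ≡ ℤxᵏ[1+x]ᵉ k (suc e) i
  ℤxᵏ[1+x]ᵉ-pascal k e zero    = trans (ℤ.+-identityʳ _) (cong +_ (sym (xᵏ[1+x]ᵉ-pascal₀ k e)))
  ℤxᵏ[1+x]ᵉ-pascal k e (suc i) =
    trans (sym (pos-+ (xᵏ[1+x]ᵉ k e (suc i)) (xᵏ[1+x]ᵉ k e i))) (cong +_ (sym (xᵏ[1+x]ᵉ-pascal k e i)))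

  private
    +[1+m]*n : ∀ m n → + (suc m ℕ.* n) ≡ (+ 1 + + m) * + n
    +[1+m]*n m n = trans (pos-* (suc m) n) (cong (_* + n) (pos-+ 1 m))

    zeros : ∀ a b → a * + 0 + b * + 0 ≡ + 0
    zeros = solve-∀

  𝒯-binomial : ∀ e i → 𝒯 e (ℤxᵏ[1+x]ᵉ 0 e) i ≡ ℤxᵏ[1+x]ᵉ 0 (suc e) i + + (2 ℕ.* e) * ℤxᵏ[1+x]ᵉ 1 (e ∸ 1) i
  𝒯-binomial e       zero          =
    sym (trans (cong (λ u → + 1 + u) (ℤ.*-zeroʳ (+ (2 ℕ.* e)))) (ℤ.+-identityʳ (+ 1)))
  𝒯-binomial zero    (suc zero)    = refl
  𝒯-binomial zero    (suc (suc i)) = zeros (+ 2 + + suc i) (+ 1 + + 0 - + suc i)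
  𝒯-binomial (suc e) (suc i)       = begin
    (+ 2 + I) * x + (+ 1 + + suc e - I) * y
      ≡⟨ cong (λ u → (+ 2 + I) * x + (+ 1 + u - I) * y) (pos-+ 1 e) ⟩
    (+ 2 + I) * x + (+ 1 + (+ 1 + E) - I) * y
      ≡⟨ regroup I E x y z ⟩
    (y + x) + (+ 2 * (+ 1 + E)) * z + ((+ 1 + E) * y - ((+ 1 + I) * x + I * y)) + + 2 * ((+ 1 + I) * x - (+ 1 + E) * z)
      ≡⟨ cong₂ (λ u v → (y + x) + (+ 2 * (+ 1 + E)) * z + ((+ 1 + E) * y - u) + + 2 * (v - (+ 1 + E) * z))
               [1+I]x+Iy≡[1+E]y [1+I]x≡[1+E]z ⟩
    (y + x) + (+ 2 * (+ 1 + E)) * z + ((+ 1 + E) * y - (+ 1 + E) * y) + + 2 * ((+ 1 + E) * z - (+ 1 + E) * z)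
      ≡⟨ cancel (y + x) ((+ 2 * (+ 1 + E)) * z) ((+ 1 + E) * y) ((+ 1 + E) * z) ⟩
    (y + x) + (+ 2 * (+ 1 + E)) * z
      ≡⟨ sym (cong₂ (λ u v → u + v * z) (pos-+ Y X) (trans (pos-* 2 (suc e)) (cong (+ 2 *_) (pos-+ 1 e)))) ⟩
    + (Y ℕ.+ X) + + (2 ℕ.* suc e) * z
      ≡⟨ cong (λ u → + u + + (2 ℕ.* suc e) * z) (sym (pascal (suc e) i)) ⟩
    + (suc (suc e) C suc i) + + (2 ℕ.* suc e) * z
      ∎
    where
    open ≡-Reasoning
    X Y Z : ℕ
    X = suc e C suc i
    Y = suc e C i
    Z = e C i
    I E x y z : ℤ
    I = + i
    E = + e
    x = + X
    y = + Y
    z = + Z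
    [1+I]x+Iy≡[1+E]y : (+ 1 + I) * x + I * y ≡ (+ 1 + E) * y
    [1+I]x+Iy≡[1+E]y = begin
      (+ 1 + I) * x + I * y           ≡⟨ sym (cong₂ _+_ (+[1+m]*n i X) (pos-* i Y)) ⟩
      + (suc i ℕ.* X) + + (i ℕ.* Y)   ≡⟨ sym (pos-+ (suc i ℕ.* X) (i ℕ.* Y)) ⟩
      + (suc i ℕ.* X ℕ.+ i ℕ.* Y)     ≡⟨ cong +_ ([1+k]*nC[1+k]+k*nCk≡n*nCk (suc e) i) ⟩
      + (suc e ℕ.* Y)                 ≡⟨ +[1+m]*n e Y ⟩
      (+ 1 + E) * y                   ∎
    [1+I]x≡[1+E]z : (+ 1 + I) * x ≡ (+ 1 + E) * z
    [1+I]x≡[1+E]z = trans (sym (+[1+m]*n i X)) (trans (cong +_ ([1+k]*[1+n]C[1+k]≡[1+n]*nCk e i)) (+[1+m]*n e Z))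
    -- The two sides differ by a combination of [1+I]x+Iy≡[1+E]y and [1+I]x≡[1+E]z.
    regroup : ∀ I E x y z → (+ 2 + I) * x + (+ 1 + (+ 1 + E) - I) * y ≡
      (y + x) + (+ 2 * (+ 1 + E)) * z + ((+ 1 + E) * y - ((+ 1 + I) * x + I * y)) + + 2 * ((+ 1 + I) * x - (+ 1 + E) * z)
    regroup = solve-∀
    cancel : ∀ a b c d → a + b + (c - c) + + 2 * (d - d) ≡ a + b
    cancel = solve-∀

  𝒯-xᵏ[1+x]ᵉ : ∀ k e D → D ≡ 2 ℕ.* k ℕ.+ e → ∀ i →
    𝒯 D (ℤxᵏ[1+x]ᵉ k e) i ≡ + suc k * ℤxᵏ[1+x]ᵉ k (suc e) i + + (2 ℕ.* e) * ℤxᵏ[1+x]ᵉ (suc k) (e ∸ 1) i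
  𝒯-xᵏ[1+x]ᵉ zero    e D refl i       =
    trans (𝒯-binomial e i)
          (cong (_+ + (2 ℕ.* e) * ℤxᵏ[1+x]ᵉ 1 (e ∸ 1) i) (sym (ℤ.*-identityˡ (ℤxᵏ[1+x]ᵉ 0 (suc e) i))))
  𝒯-xᵏ[1+x]ᵉ (suc k) e D D≡   zero    = sym (zeros (+ suc (suc k)) (+ (2 ℕ.* e)))
  𝒯-xᵏ[1+x]ᵉ (suc k) e D D≡   (suc i) rewrite trans D≡ (2[1+k]+e≡2+2k+e k e) = begin
    𝒯 (2 ℕ.+ D′) (ℤxᵏ[1+x]ᵉ (suc k) e) (suc i)   ≡⟨ 𝒯-cong (2 ℕ.+ D′) x·xᵏ[1+x]ᵉ (suc i) ⟩
    𝒯 (2 ℕ.+ D′) (shift q) (suc i)               ≡⟨ 𝒯-shift D′ q i ⟩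
    𝒯 D′ q i + q i + shift q i                   ≡⟨ cong (λ u → u + q i + shift q i) (𝒯-xᵏ[1+x]ᵉ k e D′ refl i) ⟩
    + suc k * P + W + q i + shift q i            ≡⟨ ℤ.+-assoc (+ suc k * P + W) (q i) (shift q i) ⟩
    + suc k * P + W + (q i + shift q i)          ≡⟨ cong (λ u → + suc k * P + W + u) (ℤxᵏ[1+x]ᵉ-pascal k e i) ⟩
    + suc k * P + W + P                          ≡⟨ absorb (+ suc k) P W ⟩
    (+ 1 + + suc k) * P + W                      ≡⟨ cong (λ u → u * P + W) (sym (pos-+ 1 (suc k))) ⟩
    + suc (suc k) * P + W                        ∎
    where
    open ≡-Reasoning
    D′ = 2 ℕ.* k ℕ.+ e
    q = ℤxᵏ[1+x]ᵉ k e
    P = ℤxᵏ[1+x]ᵉ k (suc e) i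
    W = + (2 ℕ.* e) * ℤxᵏ[1+x]ᵉ (suc k) (e ∸ 1) i
    x·xᵏ[1+x]ᵉ : ∀ j → ℤxᵏ[1+x]ᵉ (suc k) e j ≡ shift q j
    x·xᵏ[1+x]ᵉ zero    = refl
    x·xᵏ[1+x]ᵉ (suc j) = refl
    absorb : ∀ a P W → a * P + W + P ≡ (+ 1 + a) * P + W
    absorb = solve-∀

  -- γ k must vanish when 2k > D, where the truncated D ∸ 2k would make its term junk.
  VanishesAbove : ℕ → (ℕ → ℕ) → Set
  VanishesAbove D γ = ∀ k → D ℕ.< 2 ℕ.* k → γ k ≡ 0

  VanishesAbove-mono : ∀ {D D′ γ} → D ℕ.≤ D′ → VanishesAbove D γ → VanishesAbove D′ γ
  VanishesAbove-mono D≤D′ vanishes k D′<2k = vanishes k (ℕ.≤-<-trans D≤D′ D′<2k)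

  VanishesAbove-+ : ∀ {D a b} → VanishesAbove D a → VanishesAbove D b → VanishesAbove D (λ k → a k ℕ.+ b k)
  VanishesAbove-+ a-vanishes b-vanishes k D<2k = cong₂ ℕ._+_ (a-vanishes k D<2k) (b-vanishes k D<2k)

  γ-support : ∀ {D γ} → VanishesAbove D γ → ∀ k → γ k ≡ 0 ⊎ 2 ℕ.* k ℕ.≤ D
  γ-support {D} vanishes k with 2 ℕ.* k ℕ.≤? D
  ... | yes 2k≤D = inj₂ 2k≤D
  ... | no  2k≰D = inj₁ (vanishes k (ℕ.≰⇒> 2k≰D))

  γ-basis : ℕ → ℕ → Coeffs
  γ-basis D k = ℤxᵏ[1+x]ᵉ k (D ∸ 2 ℕ.* k)

  γ-expansion : ℕ → ℕ → (ℕ → ℕ) → Coeffs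
  γ-expansion N D γ i = ∑ N (λ k → + γ k * γ-basis D k i)

  private
    0*x≡0*y : ∀ x y → + 0 * x ≡ + 0 * y
    0*x≡0*y x y = trans (ℤ.*-zeroˡ x) (sym (ℤ.*-zeroˡ y))

  γ-expansion-extend : ∀ N M D γ → VanishesAbove D γ → D ℕ.< 2 ℕ.* N → N ℕ.≤ M → ∀ i →
    γ-expansion M D γ i ≡ γ-expansion N D γ i
  γ-expansion-extend N M D γ vanishes D<2N N≤M i =
    ∑-truncate N M (λ k → + γ k * γ-basis D k i) N≤M tail≡0
    where
    tail≡0 : ∀ k → N ℕ.≤ k → + γ k * γ-basis D k i ≡ + 0
    tail≡0 k N≤k rewrite vanishes k (ℕ.<-≤-trans D<2N (ℕ.*-monoʳ-≤ 2 N≤k)) = ℤ.*-zeroˡ (γ-basis D k i)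

  γ-expansion-+ : ∀ N D a b i → γ-expansion N D (λ k → a k ℕ.+ b k) i ≡ γ-expansion N D a i + γ-expansion N D b i
  γ-expansion-+ N D a b i = trans (∑-cong N term) (∑-+ N _ _)
    where
    term : ∀ k → + (a k ℕ.+ b k) * γ-basis D k i ≡
                 + a k * γ-basis D k i + + b k * γ-basis D k i
    term k = trans (cong (_* γ-basis D k i) (pos-+ (a k) (b k))) (ℤ.*-distribʳ-+ _ (+ a k) (+ b k))

  γ-expansion-[1+x] : ∀ N D γ → VanishesAbove D γ → ∀ i →
    γ-expansion N D γ i + shift (γ-expansion N D γ) i ≡ γ-expansion N (suc D) γ i
  γ-expansion-[1+x] N D γ vanishes i =
    trans (cong (_+_ (γ-expansion N D γ i)) (shift-∑ N t i))
          (trans (sym (∑-+ N (λ k → t k i) (λ k → shift (t k) i))) (∑-cong N term))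
    where
    t : ℕ → Coeffs
    t k j = + γ k * γ-basis D k j
    reindex : ∀ k → + γ k * ℤxᵏ[1+x]ᵉ k (suc (D ∸ 2 ℕ.* k)) i ≡ + γ k * γ-basis (suc D) k i
    reindex k with γ-support vanishes k
    ... | inj₁ γk≡0 rewrite γk≡0 = 0*x≡0*y (ℤxᵏ[1+x]ᵉ k (suc (D ∸ 2 ℕ.* k)) i) (γ-basis (suc D) k i)
    ... | inj₂ 2k≤D = cong (λ e → + γ k * ℤxᵏ[1+x]ᵉ k e i) (sym (ℕ.+-∸-assoc 1 2k≤D))
    term : ∀ k → t k i + shift (t k) i ≡ + γ k * γ-basis (suc D) k i
    term k = begin
      t k i + shift (t k) i                      ≡⟨ cong (_+_ (t k i)) (shift-* (+ γ k) q i) ⟩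
      + γ k * q i + + γ k * shift q i            ≡⟨ sym (ℤ.*-distribˡ-+ (+ γ k) (q i) (shift q i)) ⟩
      + γ k * (q i + shift q i)                  ≡⟨ cong (+ γ k *_) (ℤxᵏ[1+x]ᵉ-pascal k (D ∸ 2 ℕ.* k) i) ⟩
      + γ k * ℤxᵏ[1+x]ᵉ k (suc (D ∸ 2 ℕ.* k)) i  ≡⟨ reindex k ⟩
      + γ k * γ-basis (suc D) k i    ∎
      where
      open ≡-Reasoning
      q = γ-basis D k

  𝒯-γ : ℕ → (ℕ → ℕ) → ℕ → ℕ
  𝒯-γ D γ zero    = γ zero
  𝒯-γ D γ (suc k) = (2 ℕ.+ k) ℕ.* γ (suc k) ℕ.+ 2 ℕ.* (D ∸ 2 ℕ.* k) ℕ.* γ k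

  𝒯-γ-vanishes : ∀ {D γ} → VanishesAbove D γ → VanishesAbove (suc D) (𝒯-γ D γ)
  𝒯-γ-vanishes {D} {γ} vanishes (suc k) D+1<2k+2 = begin
    (2 ℕ.+ k) ℕ.* γ (suc k) ℕ.+ 2 ℕ.* (D ∸ 2 ℕ.* k) ℕ.* γ k
      ≡⟨ cong₂ (λ u v → (2 ℕ.+ k) ℕ.* u ℕ.+ 2 ℕ.* v ℕ.* γ k) (vanishes (suc k) D<2k+2) (ℕ.m≤n⇒m∸n≡0 D≤2k) ⟩
    (2 ℕ.+ k) ℕ.* 0 ℕ.+ 0
      ≡⟨ trans (ℕ.+-identityʳ _) (ℕ.*-zeroʳ (2 ℕ.+ k)) ⟩
    0
      ∎
    where
    open ≡-Reasoning
    D≤2k : D ℕ.≤ 2 ℕ.* k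
    D≤2k = s≤s⁻¹ (s≤s⁻¹ (ℕ.≤-trans D+1<2k+2 (ℕ.≤-reflexive (ℕ.*-suc 2 k))))
    D<2k+2 : D ℕ.< 2 ℕ.* suc k
    D<2k+2 = ℕ.<-trans (ℕ.n<1+n D) D+1<2k+2

  𝒯-γ-term : ∀ {D γ} → VanishesAbove D γ → ∀ k i →
    𝒯 D (λ j → + γ k * γ-basis D k j) i ≡
      + suc k * (+ γ k * γ-basis (suc D) k i) +
      + (2 ℕ.* (D ∸ 2 ℕ.* k)) * (+ γ k * γ-basis (suc D) (suc k) i)
  𝒯-γ-term {D} {γ} vanishes k i with γ-support vanishes k
  ... | inj₁ γk≡0 rewrite γk≡0 =
    trans (𝒯-* D (+ 0) q i) (annihilate (𝒯 D q i) (+ suc k) (+ (2 ℕ.* e)) (γ-basis (suc D) k i)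
                                        (γ-basis (suc D) (suc k) i))
    where
    e = D ∸ 2 ℕ.* k
    q = ℤxᵏ[1+x]ᵉ k e
    annihilate : ∀ t a b x y → + 0 * t ≡ a * (+ 0 * x) + b * (+ 0 * y)
    annihilate = solve-∀
  ... | inj₂ 2k≤D = begin
    𝒯 D (λ j → + γ k * q j) i
      ≡⟨ 𝒯-* D (+ γ k) q i ⟩
    + γ k * 𝒯 D q i
      ≡⟨ cong (+ γ k *_) (𝒯-xᵏ[1+x]ᵉ k e D (sym (ℕ.m+[n∸m]≡n 2k≤D)) i) ⟩
    + γ k * (+ suc k * ℤxᵏ[1+x]ᵉ k (suc e) i + + (2 ℕ.* e) * ℤxᵏ[1+x]ᵉ (suc k) (e ∸ 1) i)
      ≡⟨ distribute (+ γ k) (+ suc k) (+ (2 ℕ.* e)) _ _ ⟩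
    + suc k * (+ γ k * ℤxᵏ[1+x]ᵉ k (suc e) i) + + (2 ℕ.* e) * (+ γ k * ℤxᵏ[1+x]ᵉ (suc k) (e ∸ 1) i)
      ≡⟨ cong₂ (λ u v → + suc k * (+ γ k * ℤxᵏ[1+x]ᵉ k u i) + + (2 ℕ.* e) * (+ γ k * ℤxᵏ[1+x]ᵉ (suc k) v i))
               (sym (ℕ.+-∸-assoc 1 2k≤D)) (sym (1+D∸2[1+k]≡D∸2k∸1 D k)) ⟩
    + suc k * (+ γ k * γ-basis (suc D) k i) + + (2 ℕ.* e) * (+ γ k * γ-basis (suc D) (suc k) i)
      ∎
    where
    open ≡-Reasoning
    e = D ∸ 2 ℕ.* k
    q = ℤxᵏ[1+x]ᵉ k e
    distribute : ∀ g a b x y → g * (a * x + b * y) ≡ a * (g * x) + b * (g * y)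
    distribute = solve-∀
    1+D∸2[1+k]≡D∸2k∸1 : ∀ D k → suc D ∸ 2 ℕ.* suc k ≡ D ∸ 2 ℕ.* k ∸ 1
    1+D∸2[1+k]≡D∸2k∸1 D k = trans (cong (suc D ∸_) (ℕ.*-suc 2 k))
                                  (trans (cong (D ∸_) (ℕ.+-comm 1 (2 ℕ.* k))) (sym (ℕ.∸-+-assoc D (2 ℕ.* k) 1)))

  𝒯-γ-expansion : ∀ N D γ → VanishesAbove D γ → D ℕ.< 2 ℕ.* N → ∀ i →
    𝒯 D (γ-expansion N D γ) i ≡ γ-expansion (suc N) (suc D) (𝒯-γ D γ) i
  𝒯-γ-expansion N D γ vanishes D<2N i = begin
    𝒯 D (γ-expansion N D γ) i
      ≡⟨ 𝒯-∑ D N (λ k j → + γ k * γ-basis D k j) i ⟩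
    ∑ N (λ k → 𝒯 D (λ j → + γ k * γ-basis D k j) i)
      ≡⟨ ∑-cong N (λ k → 𝒯-γ-term vanishes k i) ⟩
    ∑ N (λ k → A k + B k)
      ≡⟨ ∑-+ N A B ⟩
    ∑ N A + ∑ N B
      ≡⟨ cong (_+ ∑ N B) (sym (∑-truncate N (suc N) A (ℕ.n≤1+n N) A-tail≡0)) ⟩
    (A 0 + ∑ N (λ k → A (suc k))) + ∑ N B
      ≡⟨ ℤ.+-assoc (A 0) (∑ N (λ k → A (suc k))) (∑ N B) ⟩
    A 0 + (∑ N (λ k → A (suc k)) + ∑ N B)
      ≡⟨ cong₂ _+_ (ℤ.*-identityˡ (+ γ 0 * b 0)) (sym (∑-+ N (λ k → A (suc k)) B)) ⟩
    + γ 0 * b 0 + ∑ N (λ k → A (suc k) + B k)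
      ≡⟨ cong (_+_ (+ γ 0 * b 0)) (∑-cong N collect) ⟩
    γ-expansion (suc N) (suc D) (𝒯-γ D γ) i
      ∎
    where
    open ≡-Reasoning
    b : ℕ → ℤ
    b k = γ-basis (suc D) k i
    A B : ℕ → ℤ
    A k = + suc k * (+ γ k * b k)
    B k = + (2 ℕ.* (D ∸ 2 ℕ.* k)) * (+ γ k * b (suc k))
    A-tail≡0 : ∀ k → N ℕ.≤ k → A k ≡ + 0
    A-tail≡0 k N≤k rewrite vanishes k (ℕ.<-≤-trans D<2N (ℕ.*-monoʳ-≤ 2 N≤k)) =
      trans (cong (+ suc k *_) (ℤ.*-zeroˡ (b k))) (ℤ.*-zeroʳ (+ suc k))
    collect : ∀ k → A (suc k) + B k ≡ + 𝒯-γ D γ (suc k) * b (suc k)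
    collect k = sym (begin
      + ((2 ℕ.+ k) ℕ.* γ (suc k) ℕ.+ c ℕ.* γ k) * b (suc k)
        ≡⟨ cong (_* b (suc k)) (trans (pos-+ ((2 ℕ.+ k) ℕ.* γ (suc k)) (c ℕ.* γ k))
                                      (cong₂ _+_ (pos-* (2 ℕ.+ k) (γ (suc k))) (pos-* c (γ k)))) ⟩
      (+ (2 ℕ.+ k) * + γ (suc k) + + c * + γ k) * b (suc k)
        ≡⟨ distribute (+ (2 ℕ.+ k)) (+ γ (suc k)) (+ c) (+ γ k) (b (suc k)) ⟩
      A (suc k) + B k
        ∎)
      where
      c = 2 ℕ.* (D ∸ 2 ℕ.* k)
      distribute : ∀ a g b h x → (a * g + b * h) * x ≡ a * (g * x) + b * (h * x)
      distribute = solve-∀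

  γ-expansion-palindromic : ∀ N D γ → VanishesAbove D γ → ∀ i → i ℕ.≤ D →
    γ-expansion N D γ (D ∸ i) ≡ γ-expansion N D γ i
  γ-expansion-palindromic N D γ vanishes i i≤D = ∑-cong N term
    where
    term : ∀ k → + γ k * γ-basis D k (D ∸ i) ≡ + γ k * γ-basis D k i
    term k with γ-support vanishes k
    ... | inj₁ γk≡0 rewrite γk≡0 = 0*x≡0*y (γ-basis D k (D ∸ i)) (γ-basis D k i)
    ... | inj₂ 2k≤D =
      cong (λ c → + γ k * + c) (xᵏ[1+x]ᵉ-palindromic k (D ∸ 2 ℕ.* k) D i (sym (ℕ.m+[n∸m]≡n 2k≤D)) i≤D)

  γ-expansion-vanishes : ∀ N D γ → VanishesAbove D γ → ∀ i → D ℕ.< i → γ-expansion N D γ i ≡ + 0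
  γ-expansion-vanishes N D γ vanishes i D<i = trans (∑-cong N term) (∑-0 N)
    where
    term : ∀ k → + γ k * γ-basis D k i ≡ + 0
    term k with γ-support vanishes k
    ... | inj₁ γk≡0 rewrite γk≡0 = ℤ.*-zeroˡ (γ-basis D k i)
    ... | inj₂ 2k≤D =
      trans (cong (λ c → + γ k * + c) (xᵏ[1+x]ᵉ-vanishes k (D ∸ 2 ℕ.* k) i k+e<i)) (ℤ.*-zeroʳ (+ γ k))
      where
      k+e<i : k ℕ.+ (D ∸ 2 ℕ.* k) ℕ.< i
      k+e<i = ℕ.≤-<-trans (ℕ.≤-trans (k+e≤2k+e k (D ∸ 2 ℕ.* k)) (ℕ.≤-reflexive (ℕ.m+[n∸m]≡n 2k≤D))) D<i

  γ-expansion-PalindromicBelow : ∀ N D γ → VanishesAbove D γ → PalindromicBelow (suc D) (γ-expansion N D γ)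
  γ-expansion-PalindromicBelow N D γ vanishes =
    (λ j j<1+D → γ-expansion-palindromic N D γ vanishes j (s≤s⁻¹ j<1+D)) , γ-expansion-vanishes N D γ vanishes

  γ-expansion-unimodal : ∀ N D γ → VanishesAbove D γ → ∀ i → 2 ℕ.* i ℕ.+ 2 ℕ.≤ D →
    γ-expansion N D γ i ℤ.≤ γ-expansion N D γ (suc i)
  γ-expansion-unimodal N D γ vanishes i 2i+2≤D = ∑-mono-≤ N term
    where
    term : ∀ k → + γ k * γ-basis D k i ℤ.≤ + γ k * γ-basis D k (suc i)
    term k with γ-support vanishes k
    ... | inj₁ γk≡0 rewrite γk≡0 =
      ℤ.≤-reflexive (0*x≡0*y (γ-basis D k i) (γ-basis D k (suc i)))
    ... | inj₂ 2k≤D = subst₂ ℤ._≤_ (pos-* (γ k) _) (pos-* (γ k) _)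
      (ℤ.+≤+ (ℕ.*-monoʳ-≤ (γ k) (xᵏ[1+x]ᵉ-unimodal k (D ∸ 2 ℕ.* k) D i (sym (ℕ.m+[n∸m]≡n 2k≤D)) 2i+2≤D)))

  γ-expansion-nonneg : ∀ N D γ i → + 0 ℤ.≤ γ-expansion N D γ i
  γ-expansion-nonneg N D γ i = subst (ℤ._≤ γ-expansion N D γ i) (∑-0 N) (∑-mono-≤ N term)
    where
    term : ∀ k → + 0 ℤ.≤ + γ k * γ-basis D k i
    term k = subst (+ 0 ℤ.≤_) (pos-* (γ k) _) (ℤ.+≤+ z≤n)

  D<2[1+D/2] : ∀ D → D ℕ.< 2 ℕ.* suc (D / 2)
  D<2[1+D/2] D = begin-strict
    D                      ≡⟨ m≡m%n+[m/n]*n D 2 ⟩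
    D % 2 ℕ.+ D / 2 ℕ.* 2  <⟨ ℕ.+-monoˡ-< (D / 2 ℕ.* 2) (m%n<n D 2) ⟩
    2 ℕ.+ D / 2 ℕ.* 2      ≡⟨ cong (2 ℕ.+_) (ℕ.*-comm (D / 2) 2) ⟩
    2 ℕ.+ 2 ℕ.* (D / 2)    ≡⟨ sym (ℕ.*-suc 2 (D / 2)) ⟩
    2 ℕ.* suc (D / 2)      ∎
    where open ℕ.≤-Reasoning

  γ-expansion⇒GammaPositive : ∀ N D γ → VanishesAbove D γ → D ℕ.< N →
    ∀ {p} → (∀ i → p i ≡ γ-expansion N D γ i) → GammaPositive D p
  γ-expansion⇒GammaPositive N D γ vanishes D<N {p} p≗ = γ , λ i → begin
    p i
      ≡⟨ p≗ i ⟩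
    γ-expansion N D γ i
      ≡⟨ γ-expansion-extend (suc (D / 2)) N D γ vanishes (D<2[1+D/2] D) (ℕ.≤-trans (s≤s (m/n≤m D 2)) D<N) i ⟩
    γ-expansion (suc (D / 2)) D γ i
      ≡⟨ ∑-cong (suc (D / 2)) (λ k → term k i) ⟩
    ∑ (suc (D / 2)) (λ k → + (γ k ℕ.* gammaBasisCoeff D k i))
      ≡⟨ sym (foldr≡∑ (λ k → γ k ℕ.* gammaBasisCoeff D k i) (suc (D / 2)) (λ k → k)) ⟩
    + foldr ℕ._+_ 0 (map (λ k → γ k ℕ.* gammaBasisCoeff D k i) (upTo (suc (D / 2))))
      ∎
    where
    open ≡-Reasoning
    term : ∀ k i → + γ k * γ-basis D k i ≡ + (γ k ℕ.* gammaBasisCoeff D k i)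
    term k i = trans (sym (pos-* (γ k) _)) (cong (λ c → + (γ k ℕ.* c)) (xᵏ[1+x]ᵉ≡gammaBasisCoeff D k i))
    foldr≡∑ : ∀ (c : ℕ → ℕ) N h → + foldr ℕ._+_ 0 (map c (applyUpTo h N)) ≡ ∑ N (λ k → + c (h k))
    foldr≡∑ c zero    h = refl
    foldr≡∑ c (suc N) h =
      trans (pos-+ (c (h 0)) _) (cong (_+_ (+ c (h 0))) (foldr≡∑ c N (λ k → h (suc k))))

module SymmetricDecomposition where

  open BigAscents using (A-coeff-recurrence₀; A-coeff-recurrence; A-coeff-vanishes)
  open CoefficientSequences
  open GammaExpansions
  open import Data.Nat as ℕ using (zero; suc; s≤s; s≤s⁻¹)
  import Data.Nat.Properties as ℕ
  open import Data.Integer as ℤ using (ℤ; +_; _+_; _*_; _-_)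
  open import Data.Integer.Properties using (pos-+; pos-*)
  import Data.Integer.Properties as ℤ
  open import Data.Integer.Tactic.RingSolver using (solve-∀)
  import Data.Nat.Tactic.RingSolver as ℕ-Solver
  open import Data.Product using (_,_)
  open import Relation.Binary.PropositionalEquality
  open import Relation.Nullary using (yes; no)

  -- The coefficients of A_{m+2}(x, 1, 1), indexed by its degree m.
  Aℤ : ℕ → Coeffs
  Aℤ m i = + A-coeff (2 ℕ.+ m) i

  Aℤ-recurrence : ∀ m j → Aℤ (suc m) j ≡ 𝒯 m (Aℤ m) j + Aℤ m j
  Aℤ-recurrence m zero    =
    trans (cong +_ (A-coeff-recurrence₀ (suc m))) (trans (pos-* 2 (A-coeff (2 ℕ.+ m) 0)) (twice (Aℤ m 0)))
    where
    twice : ∀ x → + 2 * x ≡ x + x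
    twice = solve-∀
  Aℤ-recurrence m (suc k) = begin
    Aℤ (suc m) (suc k)
      ≡⟨ cong +_ (A-coeff-recurrence (suc m) k) ⟩
    + ((3 ℕ.+ k) ℕ.* A-coeff (2 ℕ.+ m) (suc k) ℕ.+ (suc m ∸ k) ℕ.* A-coeff (2 ℕ.+ m) k)
      ≡⟨ pos-+ ((3 ℕ.+ k) ℕ.* A-coeff (2 ℕ.+ m) (suc k)) ((suc m ∸ k) ℕ.* A-coeff (2 ℕ.+ m) k) ⟩
    + ((3 ℕ.+ k) ℕ.* A-coeff (2 ℕ.+ m) (suc k)) + + ((suc m ∸ k) ℕ.* A-coeff (2 ℕ.+ m) k)
      ≡⟨ cong₂ _+_ (pos-* (3 ℕ.+ k) (A-coeff (2 ℕ.+ m) (suc k))) (pos-* (suc m ∸ k) (A-coeff (2 ℕ.+ m) k)) ⟩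
    + (3 ℕ.+ k) * x + + (suc m ∸ k) * y
      ≡⟨ cong₂ (λ u v → u * x + v) (pos-+ 3 k) truncation-harmless ⟩
    (+ 3 + + k) * x + (+ 1 + + m - + k) * y
      ≡⟨ regroup (+ k) (+ 1 + + m - + k) x y ⟩
    (+ 2 + + k) * x + (+ 1 + + m - + k) * y + x
      ∎
    where
    open ≡-Reasoning
    x = Aℤ m (suc k)
    y = Aℤ m k
    regroup : ∀ k c x y → (+ 3 + k) * x + c * y ≡ (+ 2 + k) * x + c * y + x
    regroup = solve-∀
    -- For k > m + 1 the ℕ subtraction truncates, but then y = 0.
    truncation-harmless : + (suc m ∸ k) * y ≡ (+ 1 + + m - + k) * y
    truncation-harmless with k ℕ.≤? suc m
    ... | yes k≤1+m =
      cong (_* y) (trans (sym (trans (ℤ.m-n≡m⊖n (suc m) k) (ℤ.⊖-≥ k≤1+m))) (cong (_- + k) (pos-+ 1 m)))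
    ... | no  k≰1+m rewrite A-coeff-vanishes m k (ℕ.<-trans (ℕ.n<1+n m) (ℕ.≰⇒> k≰1+m)) =
      trans (ℤ.*-zeroʳ (+ (suc m ∸ k))) (sym (ℤ.*-zeroʳ (+ 1 + + m - + k)))

  α : ℕ → ℕ → ℕ
  α zero    zero    = 2
  α zero    (suc k) = 0
  α (suc m)         = 𝒯-γ m (α m)

  -- β 1 is the general rule with β 0 = 0, stated apart because the degree m ∸ 1 of b m truncates at m = 0.
  β : ℕ → ℕ → ℕ
  β zero          k = 0
  β (suc zero)    k = α 0 k
  β (suc (suc p)) k = α (suc p) k ℕ.+ 𝒯-γ p (β (suc p)) k ℕ.+ β (suc p) k

  α-vanishes : ∀ m → VanishesAbove m (α m)
  α-vanishes zero    (suc k) _ = refl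
  α-vanishes (suc m)           = 𝒯-γ-vanishes (α-vanishes m)

  β-vanishes : ∀ m → VanishesAbove (m ∸ 1) (β m)
  β-vanishes zero          k _ = refl
  β-vanishes (suc zero)        = α-vanishes 0
  β-vanishes (suc (suc p))     =
    VanishesAbove-+ (VanishesAbove-+ (α-vanishes (suc p)) (𝒯-γ-vanishes (β-vanishes (suc p))))
                    (VanishesAbove-mono (ℕ.n≤1+n p) (β-vanishes (suc p)))

  a b : ℕ → Coeffs
  a m = γ-expansion (suc m) m (α m)
  b m = γ-expansion (suc m) (m ∸ 1) (β m)

  private
    m<2[1+m] : ∀ m → m ℕ.< 2 ℕ.* suc m
    m<2[1+m] m = ℕ.<-≤-trans (ℕ.n<1+n m) (ℕ.m≤n*m (suc m) 2)

  Aℤ≡a+b : ∀ m j → Aℤ m j ≡ a m j + b m j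
  Aℤ≡a+b zero            zero          = refl
  Aℤ≡a+b zero            (suc j)       = refl
  Aℤ≡a+b (suc zero)      zero          = refl
  Aℤ≡a+b (suc zero)      (suc zero)    = refl
  Aℤ≡a+b (suc zero)      (suc (suc j)) = refl
  Aℤ≡a+b (suc m@(suc p)) j             = begin
    Aℤ (suc m) j
      ≡⟨ Aℤ-recurrence m j ⟩
    𝒯 m (Aℤ m) j + Aℤ m j
      ≡⟨ cong₂ _+_ (𝒯-cong m (Aℤ≡a+b m) j) (Aℤ≡a+b m j) ⟩
    𝒯 m (λ i → a m i + b m i) j + (a m j + b m j)
      ≡⟨ cong (_+ (a m j + b m j)) (𝒯-+ m (a m) (b m) j) ⟩
    𝒯 m (a m) j + 𝒯 m (b m) j + (a m j + b m j)
      ≡⟨ cong (λ u → 𝒯 m (a m) j + u + (a m j + b m j)) (𝒯-suc p (b m) j) ⟩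
    𝒯 m (a m) j + (𝒯 p (b m) j + shift (b m) j) + (a m j + b m j)
      ≡⟨ regroup (𝒯 m (a m) j) (𝒯 p (b m) j) (shift (b m) j) (a m j) (b m j) ⟩
    𝒯 m (a m) j + (a m j + 𝒯 p (b m) j + (b m j + shift (b m) j))
      ≡⟨ cong₂ _+_ (𝒯-γ-expansion (suc m) m (α m) (α-vanishes m) (m<2[1+m] m) j) (sym b-step) ⟩
    a (suc m) j + b (suc m) j
      ∎
    where
    open ≡-Reasoning
    regroup : ∀ t t′ s x y → t + (t′ + s) + (x + y) ≡ t + (x + t′ + (y + s))
    regroup = solve-∀
    extend : ∀ {γ} → VanishesAbove m γ → ∀ j → γ-expansion (suc (suc m)) m γ j ≡ γ-expansion (suc m) m γ j
    extend vanishes = γ-expansion-extend (suc m) (suc (suc m)) m _ vanishes (m<2[1+m] m) (ℕ.n≤1+n (suc m))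
    b-step : b (suc m) j ≡ a m j + 𝒯 p (b m) j + (b m j + shift (b m) j)
    b-step = begin
      γ-expansion (suc (suc m)) m (λ k → α m k ℕ.+ 𝒯-γ p (β m) k ℕ.+ β m k) j
        ≡⟨ γ-expansion-+ (suc (suc m)) m (λ k → α m k ℕ.+ 𝒯-γ p (β m) k) (β m) j ⟩
      γ-expansion (suc (suc m)) m (λ k → α m k ℕ.+ 𝒯-γ p (β m) k) j + γ-expansion (suc (suc m)) m (β m) j
        ≡⟨ cong (_+ γ-expansion (suc (suc m)) m (β m) j) (γ-expansion-+ (suc (suc m)) m (α m) (𝒯-γ p (β m)) j) ⟩
      γ-expansion (suc (suc m)) m (α m) j + γ-expansion (suc (suc m)) m (𝒯-γ p (β m)) j
        + γ-expansion (suc (suc m)) m (β m) j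
        ≡⟨ cong₂ (λ u v → u + γ-expansion (suc (suc m)) m (𝒯-γ p (β m)) j + v)
                 (extend (α-vanishes m) j) (extend (VanishesAbove-mono (ℕ.n≤1+n p) (β-vanishes m)) j) ⟩
      a m j + γ-expansion (suc (suc m)) m (𝒯-γ p (β m)) j + γ-expansion (suc m) m (β m) j
        ≡⟨ cong₂ (λ u v → a m j + u + v)
                 (sym (𝒯-γ-expansion (suc m) p (β m) (β-vanishes m) (ℕ.<-trans (ℕ.n<1+n p) (m<2[1+m] m)) j))
                 (sym (γ-expansion-[1+x] (suc m) p (β m) (β-vanishes m) j)) ⟩
      a m j + 𝒯 p (b m) j + (b m j + shift (b m) j)
        ∎

  a-PalindromicBelow : ∀ m → PalindromicBelow (suc m) (a m)
  a-PalindromicBelow m = γ-expansion-PalindromicBelow (suc m) m (α m) (α-vanishes m)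

  b-PalindromicBelow : ∀ m → PalindromicBelow m (b m)
  b-PalindromicBelow zero    = (λ j ()) , (λ j _ → refl)
  b-PalindromicBelow (suc p) = γ-expansion-PalindromicBelow (suc (suc p)) p (β (suc p)) (β-vanishes (suc p))

  revA≡a+x·b : ∀ m j → revA (2 ℕ.+ m) j ≡ a m j + shift (b m) j
  revA≡a+x·b m j = begin
    revCoeff m (Aℤ m) j                        ≡⟨ revCoeff-cong m (Aℤ≡a+b m) j ⟩
    revCoeff m (λ i → a m i + b m i) j         ≡⟨ revCoeff-+ m (a m) (b m) j ⟩
    revCoeff m (a m) j + revCoeff m (b m) j    ≡⟨ cong₂ _+_ (revCoeff-id (a-PalindromicBelow m) j)
                                                             (revCoeff-shift (b-PalindromicBelow m) j) ⟩
    a m j + shift (b m) j                      ∎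
    where open ≡-Reasoning

  reverse-revA≡a+b : ∀ m j → revCoeff m (revA (2 ℕ.+ m)) j ≡ a m j + b m j
  reverse-revA≡a+b m j =
    trans (revCoeff-involutive m (Aℤ m) (λ i m<i → cong +_ (A-coeff-vanishes m i m<i)) j) (Aℤ≡a+b m j)

  x·reverse-revA≡x·a+x·b : ∀ m j → revCoeff (suc m) (revA (2 ℕ.+ m)) j ≡ shift (a m) j + shift (b m) j
  x·reverse-revA≡x·a+x·b m j =
    trans (revCoeff-suc m (revA (2 ℕ.+ m)) (revCoeff-> m (Aℤ m) (ℕ.n<1+n m)) j) (shifted j)
    where
    shifted : ∀ j → shift (revCoeff m (revA (2 ℕ.+ m))) j ≡ shift (a m) j + shift (b m) j
    shifted zero    = refl
    shifted (suc j) = reverse-revA≡a+b m j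

  symA-revA≡a : ∀ m i → symA m (revA (2 ℕ.+ m)) i ≡ a m i
  symA-revA≡a m = partialSum-[1-x] (a m) _ λ j →
    trans (cong₂ _-_ (revA≡a+x·b m j) (x·reverse-revA≡x·a+x·b m j))
          (cancel (a m j) (shift (a m) j) (shift (b m) j))
    where
    cancel : ∀ x y z → x + z - (y + z) ≡ x - y
    cancel = solve-∀

  symB-revA≡b : ∀ m i → symB m (revA (2 ℕ.+ m)) i ≡ b m i
  symB-revA≡b m = partialSum-[1-x] (b m) _ λ j →
    trans (cong₂ _-_ (reverse-revA≡a+b m j) (revA≡a+x·b m j)) (cancel (a m j) (b m j) (shift (b m) j))
    where
    cancel : ∀ x y z → x + y - (x + z) ≡ y - z
    cancel = solve-∀

  x·b≤b : ∀ m i → 2 ℕ.* i ℕ.+ 1 ℕ.≤ m → shift (b m) i ℤ.≤ b m i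
  x·b≤b m       zero    _        = γ-expansion-nonneg (suc m) (m ∸ 1) (β m) 0
  x·b≤b (suc p) (suc i) 2i+3≤1+p =
    γ-expansion-unimodal (suc (suc p)) p (β (suc p)) (β-vanishes (suc p)) i
      (s≤s⁻¹ (ℕ.≤-trans (ℕ.≤-reflexive (sym (2[1+i]+1≡1+2i+2 i))) 2i+3≤1+p))
    where
    2[1+i]+1≡1+2i+2 : ∀ i → 2 ℕ.* suc i ℕ.+ 1 ≡ suc (2 ℕ.* i ℕ.+ 2)
    2[1+i]+1≡1+2i+2 = ℕ-Solver.solve-∀

  spiral-outer : ∀ m i → 2 ℕ.* i ℕ.+ 1 ℕ.≤ m → A-coeff (2 ℕ.+ m) (m ∸ i) ℕ.≤ A-coeff (2 ℕ.+ m) i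
  spiral-outer m i 2i+1≤m = ℤ.drop‿+≤+ (begin
    + A-coeff (2 ℕ.+ m) (m ∸ i)   ≡⟨ sym (revCoeff-≤ m (Aℤ m) i≤m) ⟩
    revA (2 ℕ.+ m) i              ≡⟨ revA≡a+x·b m i ⟩
    a m i + shift (b m) i         ≤⟨ ℤ.+-monoʳ-≤ (a m i) (x·b≤b m i 2i+1≤m) ⟩
    a m i + b m i                 ≡⟨ sym (Aℤ≡a+b m i) ⟩
    + A-coeff (2 ℕ.+ m) i         ∎)
    where
    open ℤ.≤-Reasoning
    i≤m : i ℕ.≤ m
    i≤m = ℕ.≤-trans (ℕ.≤-trans (ℕ.m≤n*m i 2) (ℕ.m≤m+n (2 ℕ.* i) 1)) 2i+1≤m

  spiral-inner : ∀ m i → 2 ℕ.* i ℕ.+ 2 ℕ.≤ m → A-coeff (2 ℕ.+ m) i ℕ.≤ A-coeff (2 ℕ.+ m) (m ∸ 1 ∸ i)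
  spiral-inner m i 2i+2≤m = ℤ.drop‿+≤+ (begin
    + A-coeff (2 ℕ.+ m) i             ≡⟨ Aℤ≡a+b m i ⟩
    a m i + b m i                     ≤⟨ ℤ.+-monoˡ-≤ (b m i) (γ-expansion-unimodal (suc m) m (α m) (α-vanishes m) i 2i+2≤m) ⟩
    a m (suc i) + b m i               ≡⟨ sym (revA≡a+x·b m (suc i)) ⟩
    revA (2 ℕ.+ m) (suc i)            ≡⟨ revCoeff-≤ m (Aℤ m) 1+i≤m ⟩
    + A-coeff (2 ℕ.+ m) (m ∸ suc i)   ≡⟨ cong (λ j → + A-coeff (2 ℕ.+ m) j) (sym (ℕ.∸-+-assoc m 1 i)) ⟩
    + A-coeff (2 ℕ.+ m) (m ∸ 1 ∸ i)   ∎)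
    where
    open ℤ.≤-Reasoning
    1+i≤m : suc i ℕ.≤ m
    1+i≤m = ℕ.≤-trans (s≤s (ℕ.≤-trans (ℕ.m≤n*m i 2) (ℕ.m≤m+n (2 ℕ.* i) 1)))
                      (ℕ.≤-trans (ℕ.≤-reflexive (sym (ℕ.+-suc (2 ℕ.* i) 1))) 2i+2≤m)

open import Data.Nat using (zero; suc; s≤s)
open import Data.Nat.Properties using (n<1+n; m∸n≤m)
open import Data.Product using (_,_)
open BigAscents using (A-coeff-constant≢0; A-coeff-leading≢0; A-coeff-vanishes)
open GammaExpansions using (γ-expansion⇒GammaPositive)
open SymmetricDecomposition

proposition2p5 : ∀ (n : ℕ) → 2 ≤ n →
    (A-coeff n 0 ≢ 0 × A-coeff n (n ∸ 2) ≢ 0 × (∀ i → n ∸ 2 < i → A-coeff n i ≡ 0)) ×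
    BiGammaPositive (n ∸ 2) (revA n) ×
    Spiral (n ∸ 2) (A-coeff n)
proposition2p5 (suc (suc m)) _ =
  (A-coeff-constant≢0 m , A-coeff-leading≢0 m , A-coeff-vanishes m) ,
  ( γ-expansion⇒GammaPositive (suc m) m       (α m) (α-vanishes m) (n<1+n m)           (symA-revA≡a m)
  , γ-expansion⇒GammaPositive (suc m) (m ∸ 1) (β m) (β-vanishes m) (s≤s (m∸n≤m m 1)) (symB-revA≡b m) ) ,
  (spiral-outer m , spiral-inner m)
proposition2p5 (suc zero) (s≤s ())
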